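{- For positive integers $m$, let $\lambda_{m,3}$ denote the number of $m\times m$ binary matrices having exactly three entries equal to $1$ in each row and in each column. Let $n\ge 2$ be an integer and let $\Lambda_n^{3+}$ be the set of $n\times n$ binary matrices $X=(x_{ij})$ with exactly three $1$'s in each row and each column and with $x_{nn}=1$; put $\lambda_{n,3}^{+}=|\Lambda_n^{3+}|$. For $X\in\Lambda_n^{3+}$, let $s<t$ be the two indices in $\{1,\dots,n-1\}$ with $x_{sn}=x_{tn}=1$, let $p<q$ be the two indices in $\{1,\dots,n-1\}$ with $x_{np}=x_{nq}=1$, and let $$\widetilde X=\begin{pmatrix} x_{sp} & x_{sq}\\ x_{tp} & x_{tq}\end{pmatrix}.$$ Define $\alpha_n$ as the number of $X\in\Lambda_n^{3+}$ with $\widetilde X=\begin{pmatrix}1&1\\1&1\end{pmatrix}$; $\beta_n$ as the number of $X\in\Lambda_n^{3+}$ for which $\widetilde X$ has exactly three entries equal to $1$; $\gamma_n$ as the number of $X\in\Lambda_n^{3+}$ with $\widetilde X\in\left\{\begin{pmatrix}1&0\\1&0\end{pmatrix},\begin{pmatrix}0&1\\0&1\end{pmatrix}\right\}$; and $\eta_n$ as the number of $X\in\Lambda_n^{3+}$ with $\widetilde X=\begin{pmatrix}0&0\\0&0\end{pmatrix}$. Then $$\lambda_{n,3}^{+}=\frac{3(n-1)(3n-8)}{2}\,\lambda_{n-1,3}+\alpha_n+\beta_n+2\gamma_n-\eta_n .$$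
   Context: A binary matrix is a matrix all of whose entries lie in $\{0,1\}$. For $n=2$ the set $\Lambda_n^{3+}$ is empty and all quantities involved are $0$. -}

module Defs where

open import Data.Bool using (Bool; true; false; if_then_else_; _∧_; _∨_; not)
open import Data.Nat using (ℕ; zero; suc; _+_; _≡ᵇ_)
open import Data.Fin using (Fin; inject₁; fromℕ)
open import Data.List using (List; []; _∷_; map; concatMap; length; filterᵇ; allFin)
open import Data.Nat.ListAction using (sum)
open import Data.Maybe using (Maybe; just; nothing)
open import Data.Product using (_×_; _,_)

Mat : ℕ → Set
Mat n = Fin n → Fin n → Bool

allFuns : {A : Set} → (k : ℕ) → List A → List (Fin k → A)
allFuns zero    xs = (λ ()) ∷ []
allFuns (suc k) xs =
  concatMap (λ a → map (λ f → λ { Fin.zero → a ; (Fin.suc i) → f i }) (allFuns k xs)) xs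

allMats : (n : ℕ) → List (Mat n)
allMats n = allFuns n (allFuns n (true ∷ false ∷ []))

ones : {k : ℕ} → (Fin k → Bool) → ℕ
ones {k} v = sum (map (λ i → if v i then 1 else 0) (allFin k))

allᵇ : {k : ℕ} → (Fin k → Bool) → Bool
allᵇ {zero}  p = true
allᵇ {suc k} p = p Fin.zero ∧ allᵇ (λ i → p (Fin.suc i))

threeReg : {n : ℕ} → Mat n → Bool
threeReg X = allᵇ (λ i → ones (X i) ≡ᵇ 3) ∧ allᵇ (λ j → ones (λ i → X i j) ≡ᵇ 3)

lam3 : ℕ → ℕ
lam3 m = length (filterᵇ threeReg (allMats m))

positions : {k : ℕ} → (Fin k → Bool) → List (Fin k)
positions {k} v = filterᵇ v (allFin k)

-- Λ_n^{3+} membership for n = suc m (last index = fromℕ m).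
inLam3plus : {m : ℕ} → Mat (suc m) → Bool
inLam3plus {m} X = threeReg X ∧ X (fromℕ m) (fromℕ m)

-- The 2×2 matrix X̃ = (x_sp x_sq ; x_tp x_tq), as (x_sp , x_sq , x_tp , x_tq),
-- where s<t are the indices < n with x_sn = 1 and p<q those with x_np = 1.
-- (For X ∈ Λ_n^{3+} these are exactly two each, so the result is 'just'.)
tilde : {m : ℕ} → Mat (suc m) → Maybe (Bool × Bool × Bool × Bool)
tilde {m} X with positions (λ i → X (inject₁ i) (fromℕ m))
               | positions (λ j → X (fromℕ m) (inject₁ j))
... | s ∷ t ∷ [] | p ∷ q ∷ [] =
  just ( X (inject₁ s) (inject₁ p) , X (inject₁ s) (inject₁ q)
       , X (inject₁ t) (inject₁ p) , X (inject₁ t) (inject₁ q) )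
... | _ | _ = nothing

countPlus : ((Bool × Bool × Bool × Bool) → Bool) → ℕ → ℕ
countPlus P zero    = 0
countPlus P (suc m) = length (filterᵇ (λ X → inLam3plus X ∧ ok (tilde X)) (allMats (suc m)))
  where
  ok : Maybe (Bool × Bool × Bool × Bool) → Bool
  ok (just y) = P y
  ok nothing  = false

b2n : Bool → ℕ
b2n true = 1
b2n false = 0

lam3plus : ℕ → ℕ
lam3plus = countPlus (λ _ → true)

isAll1 isThree1 isGamma isAll0 : (Bool × Bool × Bool × Bool) → Bool
isAll1 (a , b , c , d) = a ∧ b ∧ c ∧ d
isThree1 (a , b , c , d) = (b2n a + b2n b + b2n c + b2n d) ≡ᵇ 3
isGamma (a , b , c , d) = (a ∧ not b ∧ c ∧ not d) ∨ (not a ∧ b ∧ not c ∧ d)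
isAll0 (a , b , c , d) = not a ∧ not b ∧ not c ∧ not d

alpha beta gamma eta : ℕ → ℕ
alpha = countPlus isAll1
beta  = countPlus isThree1
gamma = countPlus isGamma
eta   = countPlus isAll0

-- Write n = m + 1 and call (i, j, k, l), with i, j, k, l < m, i ≠ k and j ≠ l, a corner
-- configuration of X ∈ Λ⁺ when x_in = x_kn = x_nj = x_nl = 1 and x_ij = x_kl = 0. The other
-- ones of the last column sit at s, t and those of the last row at p, q, so X has exactly
-- 2([x_sp = x_tq = 0] + [x_sq = x_tp = 0]) corner configurations; checking the sixteen possible
-- X̃ shows that half this number plus [X̃ counted by α] + [by β] + [by γ] + [X̃ᵀ counted by γ]
-- is 1 + [X̃ counted by η], and transposing X shows that the last indicator sums to γ_n.
-- On the other hand, for fixed (i, j, k, l), deleting the last row and column and setting the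
-- entries (i, j), (k, l) to 1 is a bijection onto the matrices of Λ_{m,3} with ones at (i, j)
-- and (k, l). So the corner configurations are equinumerous with the ordered pairs of ones in
-- distinct rows and columns of matrices in Λ_{m,3}; each of the 3m ones of such a matrix shares
-- a row or column with exactly four others, giving 3m(3m − 5) λ_{m,3} in total. Comparing the
-- two counts yields 2λ⁺ + 2η = 3m(3m − 5) λ_{m,3} + 2α + 2β + 4γ.

module Submission where

open import Defs

module Counting where

  open import Data.Bool using (Bool; true; false; if_then_else_; _∧_; _∨_; not; T)
  import Data.Bool.Properties as Boolₚ
  open import Data.Nat using (ℕ; zero; suc; _+_; _*_; _≤_; z≤n; _≡ᵇ_)
  open import Data.Nat.Properties
    using ( +-assoc; +-comm; +-identityʳ; *-assoc; *-comm; *-identityˡ; *-identityʳ; *-zeroʳ; *-distribˡ-+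
          ; +-cancelʳ-≡; +-cancelʳ-≤; +-mono-≤; +-monoʳ-≤; ≤-refl; ≤-reflexive; ≤-trans; ≤-antisym
          ; ≡ᵇ⇒≡; ≡⇒≡ᵇ; +-commutativeSemigroup )
  open import Algebra.Properties.CommutativeSemigroup +-commutativeSemigroup
    using () renaming (interchange to +-interchange)
  open import Data.Nat.ListAction using (sum)
  open import Data.Nat.ListAction.Properties using (sum-++)
  open import Data.Nat.Tactic.RingSolver using (solve-∀)
  open import Data.Fin using (Fin; inject₁; fromℕ)
  open import Data.Fin.Properties using (_≟_)
  open import Data.List using (List; []; _∷_; map; concatMap; length; filterᵇ; allFin; _++_)
  import Data.List.Properties as Listₚ
  open import Data.List.Relation.Unary.All using ([]; _∷_)
  open import Data.List.Relation.Unary.AllPairs using (_∷_)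
  open import Data.List.Relation.Unary.Unique.Propositional using (Unique)
  import Data.List.Relation.Unary.Unique.Propositional.Properties as Unique
  open import Data.Maybe using (just)
  open import Data.Product using (Σ-syntax; _×_; _,_; proj₁; proj₂)
  open import Data.Sum using (_⊎_; inj₁; inj₂)
  open import Function using (_∘_; mk⇔; Equivalence)
  open import Relation.Binary.Definitions using (DecidableEquality)
  open import Relation.Nullary.Decidable using (yes; does; T?; dec-true; dec-false; does-⇔)
  open import Relation.Binary.PropositionalEquality
  open ≡-Reasoning

  private variable A B : Set

  ∑ : List A → (A → ℕ) → ℕ
  ∑ xs f = sum (map f xs)

  syntax ∑ xs (λ x → e) = ∑[ x ∈ xs ] e

  ∑-cong : (xs : List A) {f g : A → ℕ} → (∀ x → f x ≡ g x) → ∑ xs f ≡ ∑ xs g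
  ∑-cong []       f≗g = refl
  ∑-cong (x ∷ xs) f≗g = cong₂ _+_ (f≗g x) (∑-cong xs f≗g)

  ∑-zero : (xs : List A) → ∑[ x ∈ xs ] 0 ≡ 0
  ∑-zero []       = refl
  ∑-zero (x ∷ xs) = ∑-zero xs

  ∑-+ : (xs : List A) (f g : A → ℕ) → ∑[ x ∈ xs ] (f x + g x) ≡ ∑ xs f + ∑ xs g
  ∑-+ []       f g = refl
  ∑-+ (x ∷ xs) f g = begin
    f x + g x + ∑[ y ∈ xs ] (f y + g y) ≡⟨ cong (f x + g x +_) (∑-+ xs f g) ⟩
    f x + g x + (∑ xs f + ∑ xs g)         ≡⟨ +-interchange (f x) (g x) (∑ xs f) (∑ xs g) ⟩
    f x + ∑ xs f + (g x + ∑ xs g)         ∎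

  ∑-*ˡ : (xs : List A) (c : ℕ) (f : A → ℕ) → ∑[ x ∈ xs ] (c * f x) ≡ c * ∑ xs f
  ∑-*ˡ []       c f = sym (*-zeroʳ c)
  ∑-*ˡ (x ∷ xs) c f = trans (cong (c * f x +_) (∑-*ˡ xs c f)) (sym (*-distribˡ-+ c (f x) (∑ xs f)))

  ∑-*ʳ : (xs : List A) (c : ℕ) (f : A → ℕ) → ∑[ x ∈ xs ] (f x * c) ≡ ∑ xs f * c
  ∑-*ʳ xs c f = begin
    ∑[ x ∈ xs ] (f x * c) ≡⟨ ∑-cong xs (λ x → *-comm (f x) c) ⟩
    ∑[ x ∈ xs ] (c * f x) ≡⟨ ∑-*ˡ xs c f ⟩
    c * ∑ xs f            ≡⟨ *-comm c (∑ xs f) ⟩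
    ∑ xs f * c            ∎

  ∑-comm : (xs : List A) (ys : List B) (h : A → B → ℕ) →
           ∑[ x ∈ xs ] ∑[ y ∈ ys ] h x y ≡ ∑[ y ∈ ys ] ∑[ x ∈ xs ] h x y
  ∑-comm []       ys h = sym (∑-zero ys)
  ∑-comm (x ∷ xs) ys h = trans (cong (∑ ys (h x) +_) (∑-comm xs ys h))
                               (sym (∑-+ ys (h x) (λ y → ∑[ x′ ∈ xs ] h x′ y)))

  ∑-++ : (xs ys : List A) (f : A → ℕ) → ∑ (xs ++ ys) f ≡ ∑ xs f + ∑ ys f
  ∑-++ xs ys f = trans (cong sum (Listₚ.map-++ f xs ys)) (sum-++ (map f xs) (map f ys))

  ∑-concatMap : (xs : List A) (g : A → List B) (f : B → ℕ) →
                ∑ (concatMap g xs) f ≡ ∑[ x ∈ xs ] ∑ (g x) f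
  ∑-concatMap []       g f = refl
  ∑-concatMap (x ∷ xs) g f = trans (∑-++ (g x) (concatMap g xs) f) (cong (∑ (g x) f +_) (∑-concatMap xs g f))

  ∑-map : (xs : List A) (g : A → B) (f : B → ℕ) → ∑ (map g xs) f ≡ ∑[ x ∈ xs ] f (g x)
  ∑-map []       g f = refl
  ∑-map (x ∷ xs) g f = cong (f (g x) +_) (∑-map xs g f)

  ∑-filter : (p : A → Bool) (xs : List A) (f : A → ℕ) → ∑ (filterᵇ p xs) f ≡ ∑[ x ∈ xs ] (b2n (p x) * f x)
  ∑-filter p []       f = refl
  ∑-filter p (x ∷ xs) f with p x
  ... | true  = cong₂ _+_ (sym (+-identityʳ (f x))) (∑-filter p xs f)
  ... | false = ∑-filter p xs f

  length-filter : (p : A → Bool) (xs : List A) → length (filterᵇ p xs) ≡ ∑[ x ∈ xs ] b2n (p x)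
  length-filter p []       = refl
  length-filter p (x ∷ xs) with p x
  ... | true  = cong suc (length-filter p xs)
  ... | false = length-filter p xs

  ∑< : (k : ℕ) → (Fin k → ℕ) → ℕ
  ∑< k = ∑ (allFin k)

  syntax ∑< k (λ i → e) = ∑[ i < k ] e

  ∑<-suc : (k : ℕ) (f : Fin (suc k) → ℕ) → ∑< (suc k) f ≡ f Fin.zero + ∑[ i < k ] f (Fin.suc i)
  ∑<-suc k f = cong (λ xs → f Fin.zero + sum xs)
    (trans (Listₚ.map-tabulate Fin.suc f) (sym (Listₚ.map-tabulate (λ i → i) (f ∘ Fin.suc))))

  ∑<-last : (k : ℕ) (f : Fin (suc k) → ℕ) → ∑< (suc k) f ≡ ∑[ i < k ] f (inject₁ i) + f (fromℕ k)
  ∑<-last zero    f = +-identityʳ (f Fin.zero)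
  ∑<-last (suc k) f = begin
    ∑< (suc (suc k)) f
      ≡⟨ ∑<-suc (suc k) f ⟩
    f Fin.zero + ∑[ i < suc k ] f (Fin.suc i)
      ≡⟨ cong (f Fin.zero +_) (∑<-last k (f ∘ Fin.suc)) ⟩
    f Fin.zero + (∑[ i < k ] f (Fin.suc (inject₁ i)) + f (fromℕ (suc k)))
      ≡⟨ +-assoc (f Fin.zero) _ _ ⟨
    f Fin.zero + ∑[ i < k ] f (Fin.suc (inject₁ i)) + f (fromℕ (suc k))
      ≡⟨ cong (_+ f (fromℕ (suc k))) (∑<-suc k (f ∘ inject₁)) ⟨
    ∑[ i < suc k ] f (inject₁ i) + f (fromℕ (suc k)) ∎

  ∑<-const : (k c : ℕ) → ∑[ i < k ] c ≡ k * c
  ∑<-const zero    c = refl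
  ∑<-const (suc k) c = trans (∑<-suc k (λ _ → c)) (cong (c +_) (∑<-const k c))

  x+y≡x′+y′⇒≡ : ∀ {x y x′ y′} → x ≤ x′ → y ≤ y′ → x + y ≡ x′ + y′ → x ≡ x′
  x+y≡x′+y′⇒≡ {x} {y} {x′} {y′} x≤x′ y≤y′ eq =
    ≤-antisym x≤x′ (+-cancelʳ-≤ y x′ x (≤-trans (+-monoʳ-≤ x′ y≤y′) (≤-reflexive (sym eq))))

  ∑<-mono-≤ : (k : ℕ) {f g : Fin k → ℕ} → (∀ i → f i ≤ g i) → ∑< k f ≤ ∑< k g
  ∑<-mono-≤ zero    f≤g = ≤-refl
  ∑<-mono-≤ (suc k) {f} {g} f≤g = subst₂ _≤_ (sym (∑<-suc k f)) (sym (∑<-suc k g))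
    (+-mono-≤ (f≤g Fin.zero) (∑<-mono-≤ k (f≤g ∘ Fin.suc)))

  ∑<-≤-equal : (k : ℕ) {f g : Fin k → ℕ} → (∀ i → f i ≤ g i) → ∑< k f ≡ ∑< k g → ∀ i → f i ≡ g i
  ∑<-≤-equal (suc k) {f} {g} f≤g eq = λ where
      Fin.zero    → x+y≡x′+y′⇒≡ (f≤g Fin.zero) tail≤ eq′
      (Fin.suc i) → ∑<-≤-equal k (f≤g ∘ Fin.suc) (x+y≡x′+y′⇒≡ tail≤ (f≤g Fin.zero) eq″) i
    where
    tail≤ : ∑[ i < k ] f (Fin.suc i) ≤ ∑[ i < k ] g (Fin.suc i)
    tail≤ = ∑<-mono-≤ k (f≤g ∘ Fin.suc)
    eq′ : f Fin.zero + ∑[ i < k ] f (Fin.suc i) ≡ g Fin.zero + ∑[ i < k ] g (Fin.suc i)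
    eq′ = trans (sym (∑<-suc k f)) (trans eq (∑<-suc k g))
    eq″ : ∑[ i < k ] f (Fin.suc i) + f Fin.zero ≡ ∑[ i < k ] g (Fin.suc i) + g Fin.zero
    eq″ = trans (+-comm (∑[ i < k ] f (Fin.suc i)) (f Fin.zero)) (trans eq′ (+-comm (g Fin.zero) (∑[ i < k ] g (Fin.suc i))))

  ∑² : (m : ℕ) → (Fin m → Fin m → ℕ) → ℕ
  ∑² m f = ∑[ i < m ] ∑[ j < m ] f i j

  syntax ∑² m (λ i j → e) = ∑[ i ∙ j < m ] e

  ∑²-cong : (m : ℕ) {f g : Fin m → Fin m → ℕ} → (∀ i j → f i j ≡ g i j) → ∑² m f ≡ ∑² m g
  ∑²-cong m f≗g = ∑-cong (allFin m) (λ i → ∑-cong (allFin m) (f≗g i))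

  ∑²-+ : (m : ℕ) (f g : Fin m → Fin m → ℕ) → ∑[ i ∙ j < m ] (f i j + g i j) ≡ ∑² m f + ∑² m g
  ∑²-+ m f g = trans (∑-cong (allFin m) (λ i → ∑-+ (allFin m) (f i) (g i))) (∑-+ (allFin m) _ _)

  ∑²-*ˡ : (m : ℕ) (c : ℕ) (f : Fin m → Fin m → ℕ) → ∑[ i ∙ j < m ] (c * f i j) ≡ c * ∑² m f
  ∑²-*ˡ m c f = trans (∑-cong (allFin m) (λ i → ∑-*ˡ (allFin m) c (f i))) (∑-*ˡ (allFin m) c _)

  ∑-∑²-comm : (xs : List A) (m : ℕ) (h : A → Fin m → Fin m → ℕ) →
              ∑[ x ∈ xs ] ∑[ i ∙ j < m ] h x i j ≡ ∑[ i ∙ j < m ] ∑[ x ∈ xs ] h x i j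
  ∑-∑²-comm xs m h = trans (∑-comm xs (allFin m) _) (∑-cong (allFin m) (λ i → ∑-comm xs (allFin m) (λ x j → h x i j)))

  ∑-+-2* : (xs : List A) (h f : A → ℕ) → ∑[ x ∈ xs ] (h x + 2 * f x) ≡ ∑ xs h + 2 * ∑ xs f
  ∑-+-2* xs h f = trans (∑-+ xs h (λ x → 2 * f x)) (cong (∑ xs h +_) (∑-*ˡ xs 2 f))

  ∑-*-∑⁴-comm : (xs : List A) (m : ℕ) (w : A → ℕ) (h : A → Fin m → Fin m → Fin m → Fin m → ℕ) →
    ∑[ x ∈ xs ] (w x * ∑[ i ∙ j < m ] ∑[ k ∙ l < m ] h x i j k l) ≡ ∑[ i ∙ j < m ] ∑[ k ∙ l < m ] ∑[ x ∈ xs ] (w x * h x i j k l)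
  ∑-*-∑⁴-comm xs m w h = begin
    ∑[ x ∈ xs ] (w x * ∑[ i ∙ j < m ] ∑[ k ∙ l < m ] h x i j k l)
      ≡⟨ ∑-cong xs (λ x → trans (sym (∑²-*ˡ m (w x) _)) (∑²-cong m (λ i j → sym (∑²-*ˡ m (w x) (h x i j))))) ⟩
    ∑[ x ∈ xs ] ∑[ i ∙ j < m ] ∑[ k ∙ l < m ] (w x * h x i j k l)
      ≡⟨ ∑-∑²-comm xs m _ ⟩
    ∑[ i ∙ j < m ] ∑[ x ∈ xs ] ∑[ k ∙ l < m ] (w x * h x i j k l)
      ≡⟨ ∑²-cong m (λ i j → ∑-∑²-comm xs m (λ x k l → w x * h x i j k l)) ⟩
    ∑[ i ∙ j < m ] ∑[ k ∙ l < m ] ∑[ x ∈ xs ] (w x * h x i j k l) ∎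

  b2n-∧ : ∀ p q → b2n (p ∧ q) ≡ b2n p * b2n q
  b2n-∧ true  q = sym (+-identityʳ (b2n q))
  b2n-∧ false q = refl

  b2n-∨ : ∀ p q → (p ≡ true → q ≡ false) → b2n (p ∨ q) ≡ b2n p + b2n q
  b2n-∨ true  q disjoint rewrite disjoint refl = refl
  b2n-∨ false q disjoint = refl

  b2n-injective : ∀ {p q} → b2n p ≡ b2n q → p ≡ q
  b2n-injective {true}  {true}  _ = refl
  b2n-injective {false} {false} _ = refl

  b2n-mono : ∀ {p q} → (p ≡ true → q ≡ true) → b2n p ≤ b2n q
  b2n-mono {false} p⇒q = z≤n
  b2n-mono {true}  p⇒q rewrite p⇒q refl = ≤-refl

  b2n-idem : ∀ a → b2n a * b2n a ≡ b2n a
  b2n-idem true  = refl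
  b2n-idem false = refl

  inclusion-exclusion : ∀ a b → b2n (not a) * b2n (not b) + b2n a + b2n b ≡ 1 + b2n a * b2n b
  inclusion-exclusion true  true  = refl
  inclusion-exclusion true  false = refl
  inclusion-exclusion false true  = refl
  inclusion-exclusion false false = refl

  ∧-true⁻ : ∀ {p q} → p ∧ q ≡ true → p ≡ true × q ≡ true
  ∧-true⁻ {true} {true} _ = refl , refl

  ∧-true⁺ : ∀ {p q} → p ≡ true → q ≡ true → p ∧ q ≡ true
  ∧-true⁺ refl refl = refl

  Bool-ext : ∀ {p q} → (p ≡ true → q ≡ true) → (q ≡ true → p ≡ true) → p ≡ q
  Bool-ext {true}  p⇒q q⇒p = sym (p⇒q refl)
  Bool-ext {false} {true}  p⇒q q⇒p = q⇒p refl
  Bool-ext {false} {false} p⇒q q⇒p = refl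

  ∧-not-∨ : ∀ a b → (b ≡ true → a ≡ true) → a ∧ not b ∨ b ≡ a
  ∧-not-∨ true  true  _   = refl
  ∧-not-∨ false true  b⇒a = sym (b⇒a refl)
  ∧-not-∨ true  false _   = refl
  ∧-not-∨ false false _   = refl

  ∨-∧-not : ∀ a b → (b ≡ true → a ≡ false) → (a ∨ b) ∧ not b ≡ a
  ∨-∧-not true  true  b⇒¬a = sym (b⇒¬a refl)
  ∨-∧-not false true  _    = refl
  ∨-∧-not true  false _    = refl
  ∨-∧-not false false _    = refl

  disjoint-sym : ∀ {p q} → (p ≡ true → q ≡ false) → q ≡ true → p ≡ false
  disjoint-sym {false}         _ _  = refl
  disjoint-sym {true}  {true}  d _  = d refl
  disjoint-sym {true}  {false} _ ()

  ∧-not⇒false : ∀ {a b} → a ∧ not b ≡ true → b ≡ false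
  ∧-not⇒false {true} {false} _ = refl

  ≡ᵇ-true⁻ : ∀ {x y} → (x ≡ᵇ y) ≡ true → x ≡ y
  ≡ᵇ-true⁻ {x} {y} e = ≡ᵇ⇒≡ x y (Equivalence.from Boolₚ.T-≡ e)

  ≡ᵇ-true⁺ : ∀ {x y} → x ≡ y → (x ≡ᵇ y) ≡ true
  ≡ᵇ-true⁺ {x} {y} e = Equivalence.to Boolₚ.T-≡ (≡⇒≡ᵇ x y e)

  ∑-∨ : (xs : List A) (p q : A → Bool) → (∀ x → p x ≡ true → q x ≡ false) →
        ∑[ x ∈ xs ] b2n (p x ∨ q x) ≡ ∑[ x ∈ xs ] b2n (p x) + ∑[ x ∈ xs ] b2n (q x)
  ∑-∨ xs p q disjoint = trans (∑-cong xs (λ x → b2n-∨ (p x) (q x) (disjoint x))) (∑-+ xs _ _)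

  ∑-b2n-∧ : (xs : List A) (p q : A → Bool) (d : ℕ) → ∑[ x ∈ xs ] (b2n (p x) * (d * b2n (q x))) ≡ d * ∑[ x ∈ xs ] b2n (p x ∧ q x)
  ∑-b2n-∧ xs p q d = trans (∑-cong xs (λ x → trans (swap (b2n (p x)) d (b2n (q x))) (cong (d *_) (sym (b2n-∧ (p x) (q x))))))
                           (∑-*ˡ xs d _)
    where
    swap : ∀ a b c → a * (b * c) ≡ b * (a * c)
    swap a b c = trans (sym (*-assoc a b c)) (trans (cong (_* c) (*-comm a b)) (*-assoc b a c))

  module BoolEquality (_≟ᴬ_ : DecidableEquality A) where

    does-refl : ∀ x → does (x ≟ᴬ x) ≡ true
    does-refl x = dec-true (x ≟ᴬ x) refl

    does-sound : ∀ x y → does (x ≟ᴬ y) ≡ true → x ≡ y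
    does-sound x y e with x ≟ᴬ y
    ... | yes x≡y = x≡y

    does-sym : ∀ x y → does (x ≟ᴬ y) ≡ does (y ≟ᴬ x)
    does-sym x y = does-⇔ (mk⇔ sym sym) (x ≟ᴬ y) (y ≟ᴬ x)

  infix 7 _==_
  _==_ : {k : ℕ} → Fin k → Fin k → Bool
  i == j = does (i ≟ j)

  module _ {k : ℕ} where
    open BoolEquality (_≟_ {k}) public
      renaming (does-refl to ==-refl; does-sound to ==⇒≡; does-sym to ==-sym)

  ==-exclusive : {k : ℕ} {i j : Fin k} → i == j ≡ false → ∀ a → a == i ≡ true → a == j ≡ false
  ==-exclusive {j = j} i≢j a a==i = subst (λ x → x == j ≡ false) (sym (==⇒≡ a _ a==i)) i≢j

  ∑<-δ : (k : ℕ) (x : Fin k) → ∑[ y < k ] b2n (y == x) ≡ 1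
  ∑<-δ (suc k) Fin.zero    = trans (∑<-suc k (λ y → b2n (y == Fin.zero))) (cong suc (∑-zero (allFin k)))
  ∑<-δ (suc k) (Fin.suc x) = trans (∑<-suc k (λ y → b2n (y == Fin.suc x))) (∑<-δ k x)

  ∑<-δ-* : (k : ℕ) (j : Fin k) (f : Fin k → ℕ) → ∑[ b < k ] (f b * b2n (b == j)) ≡ f j
  ∑<-δ-* k j f = begin
    ∑[ b < k ] (f b * b2n (b == j)) ≡⟨ ∑-cong (allFin k) only-j ⟩
    ∑[ b < k ] (f j * b2n (b == j)) ≡⟨ ∑-*ˡ (allFin k) (f j) _ ⟩
    f j * ∑[ b < k ] b2n (b == j)   ≡⟨ cong (f j *_) (∑<-δ k j) ⟩
    f j * 1                         ≡⟨ *-identityʳ (f j) ⟩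
    f j                             ∎
    where
    only-j : ∀ b → f b * b2n (b == j) ≡ f j * b2n (b == j)
    only-j b with b == j in b==j
    ... | true  = cong (λ c → f c * 1) (==⇒≡ b j b==j)
    ... | false = trans (*-zeroʳ (f b)) (sym (*-zeroʳ (f j)))

  ∑<-δ-pair : (m c d : ℕ) (j l : Fin m) → ∑[ b < m ] (c * b2n (b == j) + d * b2n (b == l)) ≡ c + d
  ∑<-δ-pair m c d j l = trans (∑-+ (allFin m) _ _) (cong₂ _+_ (scaled c j) (scaled d l))
    where
    scaled : ∀ c j → ∑[ b < m ] (c * b2n (b == j)) ≡ c
    scaled c j = trans (∑-*ˡ (allFin m) c _) (trans (cong (c *_) (∑<-δ m j)) (*-identityʳ c))

  ∑<-pair : (m : ℕ) {i k : Fin m} → i == k ≡ false → ∑[ a < m ] b2n (a == i ∨ a == k) ≡ 2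
  ∑<-pair m {i} {k} i≢k = trans (∑-∨ (allFin m) (_== i) (_== k) (==-exclusive i≢k)) (cong₂ _+_ (∑<-δ m i) (∑<-δ m k))

  allᵇ-sound : {k : ℕ} (p : Fin k → Bool) → allᵇ p ≡ true → ∀ i → p i ≡ true
  allᵇ-sound {suc k} p e Fin.zero    = proj₁ (∧-true⁻ e)
  allᵇ-sound {suc k} p e (Fin.suc i) = allᵇ-sound (p ∘ Fin.suc) (proj₂ (∧-true⁻ {p Fin.zero} e)) i

  allᵇ-complete : {k : ℕ} (p : Fin k → Bool) → (∀ i → p i ≡ true) → allᵇ p ≡ true
  allᵇ-complete {zero}  p all = refl
  allᵇ-complete {suc k} p all = ∧-true⁺ (all Fin.zero) (allᵇ-complete (p ∘ Fin.suc) (all ∘ Fin.suc))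

  allᵇ-cong : {k : ℕ} {p q : Fin k → Bool} → (∀ i → p i ≡ q i) → allᵇ p ≡ allᵇ q
  allᵇ-cong {zero}  p≗q = refl
  allᵇ-cong {suc k} p≗q = cong₂ _∧_ (p≗q Fin.zero) (allᵇ-cong (p≗q ∘ Fin.suc))

  -- Counting matrices up to pointwise equality

  Enumerates : List A → (A → A → Bool) → Set
  Enumerates xs _≈_ = ∀ x → ∑[ y ∈ xs ] b2n (y ≈ x) ≡ 1

  ∑-reindex : (xs : List A) (ys : List B) {_≈ᴬ_ : A → A → Bool} {_≈ᴮ_ : B → B → Bool} →
    Enumerates xs _≈ᴬ_ → Enumerates ys _≈ᴮ_ → (φ : A → B) (ψ : B → A) (F : A → ℕ) (G : B → ℕ) →
    (∀ x y → b2n (x ≈ᴬ ψ y) * G y ≡ b2n (y ≈ᴮ φ x) * F x) → ∑ xs F ≡ ∑ ys G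
  ∑-reindex xs ys {_≈ᴬ_} {_≈ᴮ_} enumᴬ enumᴮ φ ψ F G match = begin
    ∑ xs F
      ≡⟨ ∑-cong xs (λ x → trans (sym (*-identityˡ (F x))) (cong (_* F x) (sym (enumᴮ (φ x))))) ⟩
    ∑[ x ∈ xs ] (∑[ y ∈ ys ] b2n (y ≈ᴮ φ x) * F x)
      ≡⟨ ∑-cong xs (λ x → sym (∑-*ʳ ys (F x) _)) ⟩
    ∑[ x ∈ xs ] ∑[ y ∈ ys ] (b2n (y ≈ᴮ φ x) * F x)
      ≡⟨ ∑-cong xs (λ x → ∑-cong ys (λ y → sym (match x y))) ⟩
    ∑[ x ∈ xs ] ∑[ y ∈ ys ] (b2n (x ≈ᴬ ψ y) * G y)
      ≡⟨ ∑-comm xs ys _ ⟩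
    ∑[ y ∈ ys ] ∑[ x ∈ xs ] (b2n (x ≈ᴬ ψ y) * G y)
      ≡⟨ ∑-cong ys (λ y → ∑-*ʳ xs (G y) _) ⟩
    ∑[ y ∈ ys ] (∑[ x ∈ xs ] b2n (x ≈ᴬ ψ y) * G y)
      ≡⟨ ∑-cong ys (λ y → trans (cong (_* G y) (enumᴬ (ψ y))) (*-identityˡ (G y))) ⟩
    ∑ ys G ∎

  pointwise : {k : ℕ} → (A → A → Bool) → (Fin k → A) → (Fin k → A) → Bool
  pointwise _≈_ f g = allᵇ (λ i → f i ≈ g i)

  allFuns-enumerates : {A : Set} (k : ℕ) (xs : List A) {_≈_ : A → A → Bool} →
    Enumerates xs _≈_ → Enumerates (allFuns k xs) (pointwise {k = k} _≈_)
  allFuns-enumerates zero    xs enum g = refl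
  allFuns-enumerates {A} (suc k) xs {_≈_} enum g =
    trans (∑-concatMap xs _ _) (trans (∑-cong xs with-head) (enum (g Fin.zero)))
    where
    g′ : Fin k → A
    g′ = g ∘ Fin.suc
    with-head : ∀ a → ∑ (map _ (allFuns k xs)) (λ f → b2n (pointwise _≈_ f g)) ≡ b2n (a ≈ g Fin.zero)
    with-head a = begin
      ∑ (map _ (allFuns k xs)) (λ f → b2n (pointwise _≈_ f g))
        ≡⟨ ∑-map (allFuns k xs) _ _ ⟩
      ∑[ f ∈ allFuns k xs ] b2n ((a ≈ g Fin.zero) ∧ pointwise _≈_ f g′)
        ≡⟨ ∑-cong (allFuns k xs) (λ f → b2n-∧ (a ≈ g Fin.zero) _) ⟩
      ∑[ f ∈ allFuns k xs ] (b2n (a ≈ g Fin.zero) * b2n (pointwise _≈_ f g′))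
        ≡⟨ ∑-*ˡ (allFuns k xs) (b2n (a ≈ g Fin.zero)) _ ⟩
      b2n (a ≈ g Fin.zero) * ∑[ f ∈ allFuns k xs ] b2n (pointwise _≈_ f g′)
        ≡⟨ cong (b2n (a ≈ g Fin.zero) *_) (allFuns-enumerates k xs enum g′) ⟩
      b2n (a ≈ g Fin.zero) * 1
        ≡⟨ *-identityʳ _ ⟩
      b2n (a ≈ g Fin.zero) ∎

  infix 4 _≗ᴹ_
  _≗ᴹ_ : {n : ℕ} → Mat n → Mat n → Set
  X ≗ᴹ Y = ∀ i j → X i j ≡ Y i j

  ≗ᴹ-sym : {n : ℕ} {X Y : Mat n} → X ≗ᴹ Y → Y ≗ᴹ X
  ≗ᴹ-sym X≗Y i j = sym (X≗Y i j)

  ≗ᴹ-trans : {n : ℕ} {X Y Z : Mat n} → X ≗ᴹ Y → Y ≗ᴹ Z → X ≗ᴹ Z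
  ≗ᴹ-trans X≗Y Y≗Z i j = trans (X≗Y i j) (Y≗Z i j)

  infix 7 _==ᵇ_
  _==ᵇ_ : Bool → Bool → Bool
  a ==ᵇ b = does (a Boolₚ.≟ b)

  open BoolEquality Boolₚ._≟_ using () renaming (does-refl to ==ᵇ-refl; does-sound to ==ᵇ⇒≡)

  infix 4 _≈ᴹ_
  _≈ᴹ_ : {n : ℕ} → Mat n → Mat n → Bool
  _≈ᴹ_ = pointwise (pointwise _==ᵇ_)

  ≈ᴹ-sound : {n : ℕ} {X Y : Mat n} → (X ≈ᴹ Y) ≡ true → X ≗ᴹ Y
  ≈ᴹ-sound {X = X} {Y} e i j = ==ᵇ⇒≡ (X i j) (Y i j) (allᵇ-sound _ (allᵇ-sound _ e i) j)

  ≈ᴹ-complete : {n : ℕ} {X Y : Mat n} → X ≗ᴹ Y → (X ≈ᴹ Y) ≡ true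
  ≈ᴹ-complete {X = X} X≗Y = allᵇ-complete _ (λ i → allᵇ-complete _ (λ j →
    subst (λ b → (X i j ==ᵇ b) ≡ true) (X≗Y i j) (==ᵇ-refl (X i j))))

  allMats-enumerates : (n : ℕ) → Enumerates (allMats n) _≈ᴹ_
  allMats-enumerates n = allFuns-enumerates n (allFuns n bools) (allFuns-enumerates n bools {_==ᵇ_} bools-enumerate)
    where
    bools : List Bool
    bools = true ∷ false ∷ []
    bools-enumerate : Enumerates bools _==ᵇ_
    bools-enumerate true  = refl
    bools-enumerate false = refl

  record Correspondence {m n : ℕ} (P : Mat m → Bool) (Q : Mat n → Bool) : Set where
    field
      to        : Mat m → Mat n
      from      : Mat n → Mat m
      to-cong   : ∀ {Z Z′} → Z ≗ᴹ Z′ → to Z ≗ᴹ to Z′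
      from-cong : ∀ {X X′} → X ≗ᴹ X′ → from X ≗ᴹ from X′
      P-cong    : ∀ {Z Z′} → Z ≗ᴹ Z′ → P Z ≡ P Z′
      Q-cong    : ∀ {X X′} → X ≗ᴹ X′ → Q X ≡ Q X′
      to-Q      : ∀ {Z} → P Z ≡ true → Q (to Z) ≡ true
      from-P    : ∀ {X} → Q X ≡ true → P (from X) ≡ true
      from∘to   : ∀ {Z} → P Z ≡ true → from (to Z) ≗ᴹ Z
      to∘from   : ∀ {X} → Q X ≡ true → to (from X) ≗ᴹ X

  count : {n : ℕ} → (Mat n → Bool) → ℕ
  count {n} P = ∑[ X ∈ allMats n ] b2n (P X)

  count-correspondence : {m n : ℕ} {P : Mat m → Bool} {Q : Mat n → Bool} → Correspondence P Q → count P ≡ count Q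
  count-correspondence {m} {n} {P} {Q} corr =
    ∑-reindex (allMats m) (allMats n) (allMats-enumerates m) (allMats-enumerates n) to from (b2n ∘ P) (b2n ∘ Q) match
    where
    open Correspondence corr
    forth : ∀ Z X → Z ≗ᴹ from X → Q X ≡ true → X ≗ᴹ to Z × P Z ≡ true
    forth Z X Z≗ Q-X = ≗ᴹ-trans (≗ᴹ-sym (to∘from Q-X)) (to-cong (≗ᴹ-sym Z≗)) , trans (P-cong Z≗) (from-P Q-X)
    back : ∀ Z X → X ≗ᴹ to Z → P Z ≡ true → Z ≗ᴹ from X × Q X ≡ true
    back Z X X≗ P-Z = ≗ᴹ-trans (≗ᴹ-sym (from∘to P-Z)) (from-cong (≗ᴹ-sym X≗)) , trans (Q-cong X≗) (to-Q P-Z)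
    match : ∀ Z X → b2n (Z ≈ᴹ from X) * b2n (Q X) ≡ b2n (X ≈ᴹ to Z) * b2n (P Z)
    match Z X = begin
      b2n (Z ≈ᴹ from X) * b2n (Q X) ≡⟨ b2n-∧ (Z ≈ᴹ from X) (Q X) ⟨
      b2n ((Z ≈ᴹ from X) ∧ Q X)     ≡⟨ cong b2n (Bool-ext ⇒ ⇐) ⟩
      b2n ((X ≈ᴹ to Z) ∧ P Z)       ≡⟨ b2n-∧ (X ≈ᴹ to Z) (P Z) ⟩
      b2n (X ≈ᴹ to Z) * b2n (P Z)   ∎
      where
      ⇒ : (Z ≈ᴹ from X) ∧ Q X ≡ true → (X ≈ᴹ to Z) ∧ P Z ≡ true
      ⇒ e with ∧-true⁻ {Z ≈ᴹ from X} e
      ... | Z≈ , Q-X with forth Z X (≈ᴹ-sound Z≈) Q-X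
      ...   | X≗ , P-Z = ∧-true⁺ (≈ᴹ-complete X≗) P-Z
      ⇐ : (X ≈ᴹ to Z) ∧ P Z ≡ true → (Z ≈ᴹ from X) ∧ Q X ≡ true
      ⇐ e with ∧-true⁻ {X ≈ᴹ to Z} e
      ... | X≈ , P-Z with back Z X (≈ᴹ-sound X≈) P-Z
      ...   | Z≗ , Q-X = ∧-true⁺ (≈ᴹ-complete Z≗) Q-X

  ones≡∑< : {k : ℕ} (v : Fin k → Bool) → ones v ≡ ∑[ i < k ] b2n (v i)
  ones≡∑< {k} v = ∑-cong (allFin k) (λ i → if≡b2n (v i))
    where
    if≡b2n : ∀ b → (if b then 1 else 0) ≡ b2n b
    if≡b2n true  = refl
    if≡b2n false = refl

  ones-cong : {k : ℕ} {v w : Fin k → Bool} → (∀ i → v i ≡ w i) → ones v ≡ ones w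
  ones-cong {k} v≗w = ∑-cong (allFin k) (λ i → cong (λ b → if b then 1 else 0) (v≗w i))

  ones-last : {m : ℕ} (w : Fin (suc m) → Bool) → ones w ≡ ∑[ b < m ] b2n (w (inject₁ b)) + b2n (w (fromℕ m))
  ones-last {m} w = trans (ones≡∑< w) (∑<-last m (b2n ∘ w))

  ones-init : {m : ℕ} (w : Fin (suc m) → Bool) → ones w ≡ 3 → w (fromℕ m) ≡ true → ones (w ∘ inject₁) ≡ 2
  ones-init {m} w three wℓ = trans (ones≡∑< (w ∘ inject₁)) (+-cancelʳ-≡ 1 _ 2 (begin
    ∑[ b < m ] b2n (w (inject₁ b)) + 1
      ≡⟨ cong (λ c → ∑[ b < m ] b2n (w (inject₁ b)) + b2n c) wℓ ⟨
    ∑[ b < m ] b2n (w (inject₁ b)) + b2n (w (fromℕ m))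
      ≡⟨ ones-last w ⟨
    ones w
      ≡⟨ three ⟩
    3 ∎))

  ones≡2⇒indicator : {m : ℕ} (w : Fin m → Bool) {i k : Fin m} → i == k ≡ false → ones w ≡ 2 →
                     w i ≡ true → w k ≡ true → ∀ a → a == i ∨ a == k ≡ w a
  ones≡2⇒indicator {m} w {i} {k} i≢k two wi wk a =
    b2n-injective (∑<-≤-equal m (λ b → b2n-mono (pair⇒w b)) (trans (∑<-pair m i≢k) (trans (sym two) (ones≡∑< w))) a)
    where
    pair⇒w : ∀ b → b == i ∨ b == k ≡ true → w b ≡ true
    pair⇒w b b∈ with b == i in b==i
    ... | true  = subst (λ x → w x ≡ true) (sym (==⇒≡ b i b==i)) wi
    ... | false = subst (λ x → w x ≡ true) (sym (==⇒≡ b k b∈)) wk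

  data InitOrLast {m : ℕ} : Fin (suc m) → Set where
    init : (a : Fin m) → InitOrLast (inject₁ a)
    last : InitOrLast (fromℕ m)

  initOrLast : {m : ℕ} (x : Fin (suc m)) → InitOrLast x
  initOrLast {zero}  Fin.zero    = last
  initOrLast {suc m} Fin.zero    = init Fin.zero
  initOrLast {suc m} (Fin.suc x) with initOrLast x
  ... | init a = init (Fin.suc a)
  ... | last   = last

  infixl 5 _∷ʳ_
  _∷ʳ_ : {m : ℕ} → (Fin m → A) → A → Fin (suc m) → A
  _∷ʳ_ {m = zero}  f d _           = d
  _∷ʳ_ {m = suc m} f d Fin.zero    = f Fin.zero
  _∷ʳ_ {m = suc m} f d (Fin.suc x) = (f ∘ Fin.suc ∷ʳ d) x

  ∷ʳ-inject₁ : {m : ℕ} (f : Fin m → A) (d : A) (a : Fin m) → (f ∷ʳ d) (inject₁ a) ≡ f a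
  ∷ʳ-inject₁ {m = suc m} f d Fin.zero    = refl
  ∷ʳ-inject₁ {m = suc m} f d (Fin.suc a) = ∷ʳ-inject₁ (f ∘ Fin.suc) d a

  ∷ʳ-last : (m : ℕ) (f : Fin m → A) (d : A) → (f ∷ʳ d) (fromℕ m) ≡ d
  ∷ʳ-last zero    f d = refl
  ∷ʳ-last (suc m) f d = ∷ʳ-last m (f ∘ Fin.suc) d

  ones-border : {m : ℕ} (w : Fin (suc m) → Bool) (u e : Fin m → Bool) → (∀ b → u b ≡ true → e b ≡ false) →
                (∀ b → w (inject₁ b) ≡ u b) → ∑[ b < m ] b2n (e b) ≡ b2n (w (fromℕ m)) →
                ones w ≡ ones (λ b → u b ∨ e b)
  ones-border {m} w u e disjoint w≗u border = begin
    ones w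
      ≡⟨ ones-last w ⟩
    ∑[ b < m ] b2n (w (inject₁ b)) + b2n (w (fromℕ m))
      ≡⟨ cong₂ _+_ (∑-cong (allFin m) (cong b2n ∘ w≗u)) (sym border) ⟩
    ∑[ b < m ] b2n (u b) + ∑[ b < m ] b2n (e b)
      ≡⟨ ∑-∨ (allFin m) u e disjoint ⟨
    ∑[ b < m ] b2n (u b ∨ e b)
      ≡⟨ ones≡∑< (λ b → u b ∨ e b) ⟨
    ones (λ b → u b ∨ e b) ∎

  record ThreeRegular {n : ℕ} (X : Mat n) : Set where
    field
      rows : ∀ i → ones (X i) ≡ 3
      cols : ∀ j → ones (λ i → X i j) ≡ 3

  threeReg-sound : {n : ℕ} {X : Mat n} → threeReg X ≡ true → ThreeRegular X
  threeReg-sound e = record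
    { rows = λ i → ≡ᵇ-true⁻ (allᵇ-sound _ (proj₁ (∧-true⁻ e)) i)
    ; cols = λ j → ≡ᵇ-true⁻ (allᵇ-sound _ (proj₂ (∧-true⁻ e)) j)
    }

  threeReg-complete : {n : ℕ} {X : Mat n} → ThreeRegular X → threeReg X ≡ true
  threeReg-complete reg = ∧-true⁺ (allᵇ-complete _ (≡ᵇ-true⁺ ∘ rows)) (allᵇ-complete _ (≡ᵇ-true⁺ ∘ cols))
    where open ThreeRegular reg

  threeReg-cong : {n : ℕ} {X Y : Mat n} → X ≗ᴹ Y → threeReg X ≡ threeReg Y
  threeReg-cong X≗Y = cong₂ _∧_ (allᵇ-cong (λ i → cong (_≡ᵇ 3) (ones-cong (X≗Y i))))
                                (allᵇ-cong (λ j → cong (_≡ᵇ 3) (ones-cong (λ i → X≗Y i j))))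

  inLam3plus-cong : {m : ℕ} {X Y : Mat (suc m)} → X ≗ᴹ Y → inLam3plus X ≡ inLam3plus Y
  inLam3plus-cong {m} X≗Y = cong₂ _∧_ (threeReg-cong X≗Y) (X≗Y (fromℕ m) (fromℕ m))

  _ᵀ : {n : ℕ} → Mat n → Mat n
  (X ᵀ) i j = X j i

  inLam3plus-transpose : {m : ℕ} (X : Mat (suc m)) → inLam3plus (X ᵀ) ≡ inLam3plus X
  inLam3plus-transpose {m} X =
    cong (_∧ X (fromℕ m) (fromℕ m)) (Boolₚ.∧-comm (allᵇ (λ j → ones (λ i → X i j) ≡ᵇ 3)) (allᵇ (λ i → ones (X i) ≡ᵇ 3)))

  length-positions : {k : ℕ} (v : Fin k → Bool) → length (positions v) ≡ ones v
  length-positions {k} v = trans (length-filter v (allFin k)) (sym (ones≡∑< v))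

  positions-unique : {k : ℕ} (v : Fin k → Bool) → Unique (positions v)
  positions-unique {k} v = Unique.filter⁺ (T? ∘ v) (Unique.allFin⁺ k)

  ∑-positions : {k : ℕ} (v : Fin k → Bool) (h : Fin k → ℕ) → ∑ (positions v) h ≡ ∑[ i < k ] (b2n (v i) * h i)
  ∑-positions {k} v = ∑-filter v (allFin k)

  positions-cong : {k : ℕ} {v w : Fin k → Bool} → (∀ i → v i ≡ w i) → positions v ≡ positions w
  positions-cong {k} {v} {w} v≗w =
    Listₚ.filter-≐ (T? ∘ v) (T? ∘ w) ((λ {i} → subst T (v≗w i)) , (λ {i} → subst T (sym (v≗w i)))) (allFin k)

  positions-pair : {k : ℕ} (v : Fin k → Bool) → ones v ≡ 2 →
                   Σ[ s ∈ Fin k ] Σ[ t ∈ Fin k ] positions v ≡ s ∷ t ∷ [] × s == t ≡ false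
  positions-pair {k} v two = pair (positions v) refl (trans (length-positions v) two) (positions-unique v)
    where
    pair : ∀ xs → positions v ≡ xs → length xs ≡ 2 → Unique xs →
           Σ[ s ∈ Fin k ] Σ[ t ∈ Fin k ] positions v ≡ s ∷ t ∷ [] × s == t ≡ false
    pair (s ∷ t ∷ []) eq _ ((s≢t ∷ []) ∷ _) = s , t , eq , dec-false (s ≟ t) s≢t

  -- The last row and column of a matrix in Λ⁺

  Quad : Set
  Quad = Bool × Bool × Bool × Bool

  record LastLines {m : ℕ} (X : Mat (suc m)) : Set where
    field
      s t p q : Fin m
      s≢t     : s == t ≡ false
      p≢q     : p == q ≡ false
      column  : positions (λ a → X (inject₁ a) (fromℕ m)) ≡ s ∷ t ∷ []
      row     : positions (λ b → X (fromℕ m) (inject₁ b)) ≡ p ∷ q ∷ []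

    X̃ : Quad
    X̃ = X (inject₁ s) (inject₁ p) , X (inject₁ s) (inject₁ q) , X (inject₁ t) (inject₁ p) , X (inject₁ t) (inject₁ q)

    tilde≡X̃ : tilde X ≡ just X̃
    tilde≡X̃ rewrite column | row = refl

  lastLines : {m : ℕ} {X : Mat (suc m)} → inLam3plus X ≡ true → LastLines X
  lastLines {m} {X} e with ∧-true⁻ {threeReg X} e
  ... | reg , corner with positions-pair _ (ones-init (λ x → X x (fromℕ m)) (cols (fromℕ m)) corner)
                        | positions-pair _ (ones-init (X (fromℕ m)) (rows (fromℕ m)) corner)
    where open ThreeRegular (threeReg-sound {X = X} reg)
  ...   | s , t , column , s≢t | p , q , row , p≢q = record
    { s = s ; t = t ; p = p ; q = q ; s≢t = s≢t ; p≢q = p≢q ; column = column ; row = row }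

  lastLines-cong : {m : ℕ} {X Y : Mat (suc m)} → X ≗ᴹ Y → LastLines X → LastLines Y
  lastLines-cong {m} X≗Y L = record
    { s = s ; t = t ; p = p ; q = q ; s≢t = s≢t ; p≢q = p≢q
    ; column = trans (positions-cong (λ a → sym (X≗Y (inject₁ a) (fromℕ m)))) column
    ; row    = trans (positions-cong (λ b → sym (X≗Y (fromℕ m) (inject₁ b)))) row
    }
    where open LastLines L

  lastLines-transpose : {m : ℕ} {X : Mat (suc m)} → LastLines X → LastLines (X ᵀ)
  lastLines-transpose L = record
    { s = p ; t = q ; p = s ; q = t ; s≢t = p≢q ; p≢q = s≢t ; column = row ; row = column }
    where open LastLines L

  -- countPlus filters with an anonymous where-bound function, which cannot be named here;
  -- unification recovers the whole predicate, and rewriting `tilde X` inside it evaluates it.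
  private
    countPlus-filter : (P : Quad → Bool) (m : ℕ) →
      Σ[ pr ∈ (Mat (suc m) → Bool) ] countPlus P (suc m) ≡ length (filterᵇ pr (allMats (suc m)))
    countPlus-filter P m = _ , refl

  plusPred : (Quad → Bool) → (m : ℕ) → Mat (suc m) → Bool
  plusPred P m = proj₁ (countPlus-filter P m)

  countPlus≡count : (P : Quad → Bool) (m : ℕ) → countPlus P (suc m) ≡ count (plusPred P m)
  countPlus≡count P m = trans (proj₂ (countPlus-filter P m)) (length-filter _ (allMats (suc m)))

  plusPred-outside : (P : Quad → Bool) {m : ℕ} {X : Mat (suc m)} → inLam3plus X ≡ false → plusPred P m X ≡ false
  plusPred-outside P e rewrite e = refl

  plusPred-just : (P : Quad → Bool) {m : ℕ} {X : Mat (suc m)} {y : Quad} → tilde X ≡ just y → plusPred P m X ≡ inLam3plus X ∧ P y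
  plusPred-just P e rewrite e = refl

  plusPred-inside : (P : Quad → Bool) {m : ℕ} {X : Mat (suc m)} (e : inLam3plus X ≡ true) →
                    plusPred P m X ≡ P (LastLines.X̃ (lastLines {X = X} e))
  plusPred-inside P {X = X} e = trans (plusPred-just P {X = X} (LastLines.tilde≡X̃ L)) (cong (_∧ P (LastLines.X̃ L)) e)
    where
    L : LastLines X
    L = lastLines e

  plusPred-cong : (P : Quad → Bool) {m : ℕ} {X Y : Mat (suc m)} → X ≗ᴹ Y → plusPred P m X ≡ plusPred P m Y
  plusPred-cong P {m} {X} {Y} X≗Y = by-membership (inLam3plus X) refl
    where
    by-membership : ∀ b → inLam3plus X ≡ b → plusPred P m X ≡ plusPred P m Y
    by-membership false e = trans (plusPred-outside P {X = X} e) (sym (plusPred-outside P {X = Y} (trans (sym (inLam3plus-cong X≗Y)) e)))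
    by-membership true  e = begin
      plusPred P m X                    ≡⟨ plusPred-just P {X = X} (LastLines.tilde≡X̃ L) ⟩
      inLam3plus X ∧ P (LastLines.X̃ L)  ≡⟨ cong₂ (λ b y → b ∧ P y) (inLam3plus-cong X≗Y) X̃≡Ỹ ⟩
      inLam3plus Y ∧ P (LastLines.X̃ L′) ≡⟨ plusPred-just P {X = Y} (LastLines.tilde≡X̃ L′) ⟨
      plusPred P m Y                    ∎
      where
      L : LastLines X
      L = lastLines e
      L′ : LastLines Y
      L′ = lastLines-cong X≗Y L
      X̃≡Ỹ : LastLines.X̃ L ≡ LastLines.X̃ L′
      X̃≡Ỹ = cong₂ _,_ (X≗Y _ _) (cong₂ _,_ (X≗Y _ _) (cong₂ _,_ (X≗Y _ _) (X≗Y _ _)))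

  transposeQ : Quad → Quad
  transposeQ (a , b , c , d) = a , c , b , d

  isRowPair : Quad → Bool
  isRowPair = isGamma ∘ transposeQ

  plusPred-transpose : {m : ℕ} (X : Mat (suc m)) → plusPred isGamma m (X ᵀ) ≡ plusPred isRowPair m X
  plusPred-transpose {m} X = by-membership (inLam3plus X) refl
    where
    by-membership : ∀ b → inLam3plus X ≡ b → plusPred isGamma m (X ᵀ) ≡ plusPred isRowPair m X
    by-membership false e = trans (plusPred-outside isGamma {X = X ᵀ} (trans (inLam3plus-transpose X) e)) (sym (plusPred-outside isRowPair {X = X} e))
    by-membership true  e = begin
      plusPred isGamma m (X ᵀ)
        ≡⟨ plusPred-just isGamma {X = X ᵀ} (LastLines.tilde≡X̃ (lastLines-transpose L)) ⟩
      inLam3plus (X ᵀ) ∧ isRowPair (LastLines.X̃ L)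
        ≡⟨ cong (_∧ isRowPair (LastLines.X̃ L)) (inLam3plus-transpose X) ⟩
      inLam3plus X ∧ isRowPair (LastLines.X̃ L)
        ≡⟨ plusPred-just isRowPair {X = X} (LastLines.tilde≡X̃ L) ⟨
      plusPred isRowPair m X ∎
      where
      L : LastLines X
      L = lastLines e

  transpose-correspondence : (m : ℕ) → Correspondence (plusPred isRowPair m) (plusPred isGamma m)
  transpose-correspondence m = record
    { to        = _ᵀ
    ; from      = _ᵀ
    ; to-cong   = λ X≗Y i j → X≗Y j i
    ; from-cong = λ X≗Y i j → X≗Y j i
    ; P-cong    = plusPred-cong isRowPair
    ; Q-cong    = plusPred-cong isGamma
    ; to-Q      = λ {X} → trans (plusPred-transpose X)
    ; from-P    = λ {X} → trans (sym (plusPred-transpose (X ᵀ)))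
    ; from∘to   = λ _ _ _ → refl
    ; to∘from   = λ _ _ _ → refl
    }

  -- Pairs of ones in distinct rows and columns

  apart : {m : ℕ} → Fin m → Fin m → Fin m → Fin m → ℕ
  apart i j k l = b2n (not (i == k)) * b2n (not (j == l))

  pairsApart : {m : ℕ} → Mat m → ℕ
  pairsApart {m} Z = ∑[ i ∙ j < m ] ∑[ k ∙ l < m ] (apart i j k l * (b2n (Z i j) * b2n (Z k l)))

  module _ {m : ℕ} {Z : Mat m} (reg : ThreeRegular Z) where

    private
      z : Fin m → Fin m → ℕ
      z k l = b2n (Z k l)

      row-sum : ∀ k → ∑[ l < m ] z k l ≡ 3
      row-sum k = trans (sym (ones≡∑< (Z k))) (ThreeRegular.rows reg k)

      col-sum : ∀ l → ∑[ k < m ] z k l ≡ 3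
      col-sum l = trans (sym (ones≡∑< (λ k → Z k l))) (ThreeRegular.cols reg l)

      total : ∑² m z ≡ 3 * m
      total = trans (∑-cong (allFin m) row-sum) (trans (∑<-const m 3) (*-comm m 3))

      in-row : ∀ i → ∑[ k ∙ l < m ] (z k l * b2n (k == i)) ≡ 3
      in-row i = begin
        ∑[ k ∙ l < m ] (z k l * b2n (k == i))
          ≡⟨ ∑-cong (allFin m) (λ k → ∑-*ʳ (allFin m) (b2n (k == i)) (z k)) ⟩
        ∑[ k < m ] (∑[ l < m ] z k l * b2n (k == i))
          ≡⟨ ∑<-δ-* m i (λ k → ∑[ l < m ] z k l) ⟩
        ∑[ l < m ] z i l
          ≡⟨ row-sum i ⟩
        3 ∎

      in-col : ∀ j → ∑[ k ∙ l < m ] (z k l * b2n (l == j)) ≡ 3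
      in-col j = trans (∑-cong (allFin m) (λ k → ∑<-δ-* m j (z k))) (col-sum j)

      at : ∀ i j → ∑[ k ∙ l < m ] (z k l * (b2n (k == i) * b2n (l == j))) ≡ z i j
      at i j = begin
        ∑[ k ∙ l < m ] (z k l * (b2n (k == i) * b2n (l == j)))
          ≡⟨ ∑²-cong m (λ k l → reorder (z k l) (b2n (k == i)) (b2n (l == j))) ⟩
        ∑[ k ∙ l < m ] (z k l * b2n (k == i) * b2n (l == j))
          ≡⟨ ∑-cong (allFin m) (λ k → ∑<-δ-* m j (λ l → z k l * b2n (k == i))) ⟩
        ∑[ k < m ] (z k j * b2n (k == i))
          ≡⟨ ∑<-δ-* m i (λ k → z k j) ⟩
        z i j ∎
        where
        reorder : ∀ a b c → a * (b * c) ≡ a * b * c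
        reorder a b c = sym (*-assoc a b c)

    ones-apart-from : ∀ i j → ∑[ k ∙ l < m ] (z k l * apart i j k l) + 6 ≡ 3 * m + z i j
    ones-apart-from i j = begin
      R + 6
        ≡⟨ cong (R +_) (cong₂ _+_ (in-row i) (in-col j)) ⟨
      R + (∑[ k ∙ l < m ] (z k l * b2n (k == i)) + ∑[ k ∙ l < m ] (z k l * b2n (l == j)))
        ≡⟨ +-assoc R _ _ ⟨
      R + ∑[ k ∙ l < m ] (z k l * b2n (k == i)) + ∑[ k ∙ l < m ] (z k l * b2n (l == j))
        ≡⟨ cong (_+ _) (∑²-+ m _ _) ⟨
      ∑[ k ∙ l < m ] (z k l * apart i j k l + z k l * b2n (k == i)) + ∑[ k ∙ l < m ] (z k l * b2n (l == j))
        ≡⟨ ∑²-+ m _ _ ⟨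
      ∑[ k ∙ l < m ] (z k l * apart i j k l + z k l * b2n (k == i) + z k l * b2n (l == j))
        ≡⟨ ∑²-cong m (λ k l → per-cell k l) ⟩
      ∑[ k ∙ l < m ] (z k l + z k l * (b2n (k == i) * b2n (l == j)))
        ≡⟨ ∑²-+ m _ _ ⟩
      ∑² m z + ∑[ k ∙ l < m ] (z k l * (b2n (k == i) * b2n (l == j)))
        ≡⟨ cong₂ _+_ total (at i j) ⟩
      3 * m + z i j ∎
      where
      R : ℕ
      R = ∑[ k ∙ l < m ] (z k l * apart i j k l)
      per-cell : ∀ k l → z k l * apart i j k l + z k l * b2n (k == i) + z k l * b2n (l == j)
                          ≡ z k l + z k l * (b2n (k == i) * b2n (l == j))
      per-cell k l = begin
        z k l * apart i j k l + z k l * b2n (k == i) + z k l * b2n (l == j)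
          ≡⟨ cong (λ x → z k l * x + z k l * b2n (k == i) + z k l * b2n (l == j))
                  (cong₂ (λ a b → b2n (not a) * b2n (not b)) (==-sym i k) (==-sym j l)) ⟩
        z k l * (b2n (not (k == i)) * b2n (not (l == j))) + z k l * b2n (k == i) + z k l * b2n (l == j)
          ≡⟨ cong (_+ z k l * b2n (l == j)) (*-distribˡ-+ (z k l) _ _) ⟨
        z k l * (b2n (not (k == i)) * b2n (not (l == j)) + b2n (k == i)) + z k l * b2n (l == j)
          ≡⟨ *-distribˡ-+ (z k l) _ _ ⟨
        z k l * (b2n (not (k == i)) * b2n (not (l == j)) + b2n (k == i) + b2n (l == j))
          ≡⟨ cong (z k l *_) (inclusion-exclusion (k == i) (l == j)) ⟩
        z k l * (1 + b2n (k == i) * b2n (l == j))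
          ≡⟨ *-distribˡ-+ (z k l) 1 _ ⟩
        z k l * 1 + z k l * (b2n (k == i) * b2n (l == j))
          ≡⟨ cong (_+ z k l * (b2n (k == i) * b2n (l == j))) (*-identityʳ (z k l)) ⟩
        z k l + z k l * (b2n (k == i) * b2n (l == j)) ∎

    pairsApart-regular : pairsApart Z + 6 * (3 * m) ≡ 3 * m * (3 * m) + 3 * m
    pairsApart-regular = begin
      pairsApart Z + 6 * (3 * m)
        ≡⟨ cong₂ _+_ (∑²-cong m (λ i j → factor i j)) (cong (6 *_) total) ⟨
      ∑[ i ∙ j < m ] (z i j * apartFrom i j) + 6 * ∑² m z
        ≡⟨ cong (∑[ i ∙ j < m ] (z i j * apartFrom i j) +_) (∑²-*ˡ m 6 z) ⟨
      ∑[ i ∙ j < m ] (z i j * apartFrom i j) + ∑[ i ∙ j < m ] (6 * z i j)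
        ≡⟨ ∑²-+ m _ _ ⟨
      ∑[ i ∙ j < m ] (z i j * apartFrom i j + 6 * z i j)
        ≡⟨ ∑²-cong m (λ i j → per-one i j) ⟩
      ∑[ i ∙ j < m ] (3 * m * z i j + z i j)
        ≡⟨ ∑²-+ m _ _ ⟩
      ∑[ i ∙ j < m ] (3 * m * z i j) + ∑² m z
        ≡⟨ cong (_+ ∑² m z) (∑²-*ˡ m (3 * m) z) ⟩
      3 * m * ∑² m z + ∑² m z
        ≡⟨ cong₂ _+_ (cong (3 * m *_) total) total ⟩
      3 * m * (3 * m) + 3 * m ∎
      where
      apartFrom : Fin m → Fin m → ℕ
      apartFrom i j = ∑[ k ∙ l < m ] (z k l * apart i j k l)
      factor : ∀ i j → z i j * apartFrom i j ≡ ∑[ k ∙ l < m ] (apart i j k l * (z i j * z k l))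
      factor i j = begin
        z i j * apartFrom i j
          ≡⟨ ∑²-*ˡ m (z i j) _ ⟨
        ∑[ k ∙ l < m ] (z i j * (z k l * apart i j k l))
          ≡⟨ ∑²-cong m (λ k l → rotate (z i j) (z k l) (apart i j k l)) ⟩
        ∑[ k ∙ l < m ] (apart i j k l * (z i j * z k l)) ∎
        where
        rotate : ∀ a b c → a * (b * c) ≡ c * (a * b)
        rotate a b c = trans (sym (*-assoc a b c)) (*-comm (a * b) c)
      per-one : ∀ i j → z i j * apartFrom i j + 6 * z i j ≡ 3 * m * z i j + z i j
      per-one i j = begin
        z i j * apartFrom i j + 6 * z i j ≡⟨ cong (z i j * apartFrom i j +_) (*-comm 6 (z i j)) ⟩
        z i j * apartFrom i j + z i j * 6 ≡⟨ *-distribˡ-+ (z i j) (apartFrom i j) 6 ⟨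
        z i j * (apartFrom i j + 6)       ≡⟨ cong (z i j *_) (ones-apart-from i j) ⟩
        z i j * (3 * m + z i j)           ≡⟨ *-distribˡ-+ (z i j) (3 * m) (z i j) ⟩
        z i j * (3 * m) + z i j * z i j   ≡⟨ cong₂ _+_ (*-comm (z i j) (3 * m)) (b2n-idem (Z i j)) ⟩
        3 * m * z i j + z i j             ∎

  lam3≡count : (m : ℕ) → lam3 m ≡ count (threeReg {m})
  lam3≡count m = length-filter threeReg (allMats m)

  regular-total : (m : ℕ) → ∑[ Z ∈ allMats m ] (b2n (threeReg Z) * pairsApart Z) + lam3 m * (6 * (3 * m))
                           ≡ lam3 m * (3 * m * (3 * m) + 3 * m)
  regular-total m rewrite lam3≡count m = begin
    ∑[ Z ∈ allMats m ] (b2n (threeReg Z) * pairsApart Z) + count (threeReg {m}) * (6 * (3 * m))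
      ≡⟨ cong (∑[ Z ∈ allMats m ] (b2n (threeReg Z) * pairsApart Z) +_) (∑-*ʳ (allMats m) _ (b2n ∘ threeReg)) ⟨
    ∑[ Z ∈ allMats m ] (b2n (threeReg Z) * pairsApart Z) + ∑[ Z ∈ allMats m ] (b2n (threeReg Z) * (6 * (3 * m)))
      ≡⟨ ∑-+ (allMats m) _ _ ⟨
    ∑[ Z ∈ allMats m ] (b2n (threeReg Z) * pairsApart Z + b2n (threeReg Z) * (6 * (3 * m)))
      ≡⟨ ∑-cong (allMats m) (λ Z → by-regularity Z (threeReg Z) refl) ⟩
    ∑[ Z ∈ allMats m ] (b2n (threeReg Z) * (3 * m * (3 * m) + 3 * m))
      ≡⟨ ∑-*ʳ (allMats m) _ (b2n ∘ threeReg) ⟩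
    count (threeReg {m}) * (3 * m * (3 * m) + 3 * m) ∎
    where
    by-regularity : ∀ Z b → threeReg Z ≡ b → b2n (threeReg Z) * pairsApart Z + b2n (threeReg Z) * (6 * (3 * m))
                                         ≡ b2n (threeReg Z) * (3 * m * (3 * m) + 3 * m)
    by-regularity Z false e rewrite e = refl
    by-regularity Z true  e rewrite e = trans (cong₂ _+_ (*-identityˡ (pairsApart Z)) (*-identityˡ (6 * (3 * m))))
                                           (trans (pairsApart-regular (threeReg-sound {X = Z} e)) (sym (*-identityˡ _)))

  -- Deleting the last row and column

  corners : {m : ℕ} → Mat (suc m) → Fin m → Fin m → Fin m → Fin m → Bool
  corners {m} X i j k l =
    X (inject₁ i) (fromℕ m) ∧ X (inject₁ k) (fromℕ m) ∧ X (fromℕ m) (inject₁ j) ∧ X (fromℕ m) (inject₁ l) ∧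
    not (X (inject₁ i) (inject₁ j)) ∧ not (X (inject₁ k) (inject₁ l))

  corners-cong : {m : ℕ} {X Y : Mat (suc m)} → X ≗ᴹ Y → ∀ i j k l → corners X i j k l ≡ corners Y i j k l
  corners-cong X≗Y i j k l =
    cong₂ _∧_ (X≗Y _ _) (cong₂ _∧_ (X≗Y _ _) (cong₂ _∧_ (X≗Y _ _) (cong₂ _∧_ (X≗Y _ _)
      (cong₂ _∧_ (cong not (X≗Y _ _)) (cong not (X≗Y _ _))))))

  record CornerFacts {m : ℕ} (X : Mat (suc m)) (i j k l : Fin m) : Set where
    field
      column-i : X (inject₁ i) (fromℕ m) ≡ true
      column-k : X (inject₁ k) (fromℕ m) ≡ true
      row-j    : X (fromℕ m) (inject₁ j) ≡ true
      row-l    : X (fromℕ m) (inject₁ l) ≡ true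
      hole-ij  : X (inject₁ i) (inject₁ j) ≡ false
      hole-kl  : X (inject₁ k) (inject₁ l) ≡ false

  corners-sound : {m : ℕ} (X : Mat (suc m)) (i j k l : Fin m) → corners X i j k l ≡ true → CornerFacts X i j k l
  corners-sound {m} X i j k l e
    with X (inject₁ i) (fromℕ m) in ci | X (inject₁ k) (fromℕ m) in ck | X (fromℕ m) (inject₁ j) in rj
       | X (fromℕ m) (inject₁ l) in rl | X (inject₁ i) (inject₁ j) in ij | X (inject₁ k) (inject₁ l) in kl
  ... | true | true | true | true | false | false = record
    { column-i = ci ; column-k = ck ; row-j = rj ; row-l = rl ; hole-ij = ij ; hole-kl = kl }

  onesAt : {m : ℕ} (i j k l : Fin m) → Mat m → Bool
  onesAt i j k l Z = threeReg Z ∧ Z i j ∧ Z k l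

  cornersAt : {m : ℕ} (i j k l : Fin m) → Mat (suc m) → Bool
  cornersAt i j k l X = inLam3plus X ∧ corners X i j k l

  module LastLineDeletion {m : ℕ} (i j k l : Fin m) (i≢k : i == k ≡ false) (j≢l : j == l ≡ false) where

    private
      ι : Fin m → Fin (suc m)
      ι = inject₁
      ℓ : Fin (suc m)
      ℓ = fromℕ m

    marked : Fin m → Fin m → Bool
    marked a b = a == i ∧ b == j ∨ a == k ∧ b == l

    lastColumn lastRow : Fin m → Bool
    lastColumn a = a == i ∨ a == k
    lastRow    b = b == j ∨ b == l

    shrink : Mat (suc m) → Mat m
    shrink X a b = X (ι a) (ι b) ∨ marked a b

    extend : Mat m → Mat (suc m)
    extend Z = (λ a → (λ b → Z a b ∧ not (marked a b)) ∷ʳ lastColumn a) ∷ʳ (lastRow ∷ʳ true)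

    marked-cases : ∀ {a b} → marked a b ≡ true → a ≡ i × b ≡ j ⊎ a ≡ k × b ≡ l
    marked-cases {a} {b} e with a == i in a==i | b == j in b==j
    ... | true  | true  = inj₁ (==⇒≡ a i a==i , ==⇒≡ b j b==j)
    ... | true  | false = inj₂ (==⇒≡ a k (proj₁ (∧-true⁻ e)) , ==⇒≡ b l (proj₂ (∧-true⁻ {a == k} e)))
    ... | false | _     = inj₂ (==⇒≡ a k (proj₁ (∧-true⁻ e)) , ==⇒≡ b l (proj₂ (∧-true⁻ {a == k} e)))

    marked-ij : marked i j ≡ true
    marked-ij rewrite ==-refl i | ==-refl j = refl

    marked-kl : marked k l ≡ true
    marked-kl rewrite ==-refl k | ==-refl l = Boolₚ.∨-zeroʳ _

    private
      b2n-marked : ∀ a b → b2n (marked a b) ≡ b2n (a == i) * b2n (b == j) + b2n (a == k) * b2n (b == l)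
      b2n-marked a b = trans (b2n-∨ (a == i ∧ b == j) _ one-cell)
                             (cong₂ _+_ (b2n-∧ (a == i) (b == j)) (b2n-∧ (a == k) (b == l)))
        where
        one-cell : a == i ∧ b == j ≡ true → a == k ∧ b == l ≡ false
        one-cell e = cong (_∧ b == l) (==-exclusive i≢k a (proj₁ (∧-true⁻ e)))

      b2n-line : ∀ (x x′ y′ : Fin m) → x′ == y′ ≡ false → b2n (x == x′ ∨ x == y′) ≡ b2n (x == x′) + b2n (x == y′)
      b2n-line x x′ y′ x′≢y′ = b2n-∨ (x == x′) (x == y′) (==-exclusive x′≢y′ x)

    marked-row : ∀ a → ∑[ b < m ] b2n (marked a b) ≡ b2n (lastColumn a)
    marked-row a = trans (∑-cong (allFin m) (b2n-marked a))
                         (trans (∑<-δ-pair m (b2n (a == i)) (b2n (a == k)) j l) (sym (b2n-line a i k i≢k)))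

    marked-column : ∀ b → ∑[ a < m ] b2n (marked a b) ≡ b2n (lastRow b)
    marked-column b = trans (∑-cong (allFin m) (λ a → trans (b2n-marked a b) (cong₂ _+_ (*-comm (b2n (a == i)) (b2n (b == j))) (*-comm (b2n (a == k)) (b2n (b == l))))))
                            (trans (∑<-δ-pair m (b2n (b == j)) (b2n (b == l)) i k) (sym (b2n-line b j l j≢l)))

    module _ (Z : Mat m) where

      private
        row : Fin m → Fin (suc m) → Bool
        row a = (λ b → Z a b ∧ not (marked a b)) ∷ʳ lastColumn a

      extend-inner : ∀ a b → extend Z (ι a) (ι b) ≡ Z a b ∧ not (marked a b)
      extend-inner a b = trans (cong (λ r → r (ι b)) (∷ʳ-inject₁ row (lastRow ∷ʳ true) a)) (∷ʳ-inject₁ _ (lastColumn a) b)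

      extend-column : ∀ a → extend Z (ι a) ℓ ≡ lastColumn a
      extend-column a = trans (cong (λ r → r ℓ) (∷ʳ-inject₁ row (lastRow ∷ʳ true) a)) (∷ʳ-last m _ (lastColumn a))

      extend-row : ∀ b → extend Z ℓ (ι b) ≡ lastRow b
      extend-row b = trans (cong (λ r → r (ι b)) (∷ʳ-last m row (lastRow ∷ʳ true))) (∷ʳ-inject₁ lastRow true b)

      extend-corner : extend Z ℓ ℓ ≡ true
      extend-corner = trans (cong (λ r → r ℓ) (∷ʳ-last m row (lastRow ∷ʳ true))) (∷ʳ-last m lastRow true)

    lastColumn-i : lastColumn i ≡ true
    lastColumn-i rewrite ==-refl i = refl

    lastColumn-k : lastColumn k ≡ true
    lastColumn-k rewrite ==-refl k = Boolₚ.∨-zeroʳ _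

    lastRow-j : lastRow j ≡ true
    lastRow-j rewrite ==-refl j = refl

    lastRow-l : lastRow l ≡ true
    lastRow-l rewrite ==-refl l = Boolₚ.∨-zeroʳ _

    extend-cong : ∀ {Z Z′} → Z ≗ᴹ Z′ → extend Z ≗ᴹ extend Z′
    extend-cong {Z} {Z′} Z≗Z′ x y with initOrLast x | initOrLast y
    ... | init a | init b = trans (extend-inner Z a b) (trans (cong (_∧ not (marked a b)) (Z≗Z′ a b)) (sym (extend-inner Z′ a b)))
    ... | init a | last   = trans (extend-column Z a) (sym (extend-column Z′ a))
    ... | last   | init b = trans (extend-row Z b) (sym (extend-row Z′ b))
    ... | last   | last   = trans (extend-corner Z) (sym (extend-corner Z′))

    shrink-cong : ∀ {X X′} → X ≗ᴹ X′ → shrink X ≗ᴹ shrink X′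
    shrink-cong X≗X′ a b = cong (_∨ marked a b) (X≗X′ (ι a) (ι b))

    module OnesAt {Z : Mat m} (rt : onesAt i j k l Z ≡ true) where

      regular : ThreeRegular Z
      regular = threeReg-sound (proj₁ (∧-true⁻ rt))

      marked⇒one : ∀ a b → marked a b ≡ true → Z a b ≡ true
      marked⇒one a b e with marked-cases {a} {b} e
      ... | inj₁ (refl , refl) = proj₁ (∧-true⁻ (proj₂ (∧-true⁻ {threeReg Z} rt)))
      ... | inj₂ (refl , refl) = proj₂ (∧-true⁻ {Z i j} (proj₂ (∧-true⁻ {threeReg Z} rt)))

      extend-rows : ∀ x → ones (extend Z x) ≡ 3
      extend-rows x with initOrLast x
      ... | init a = begin
        ones (extend Z (ι a))
          ≡⟨ ones-border (extend Z (ι a)) _ (marked a) (λ b → ∧-not⇒false) (extend-inner Z a)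
                         (trans (marked-row a) (cong b2n (sym (extend-column Z a)))) ⟩
        ones (λ b → Z a b ∧ not (marked a b) ∨ marked a b)
          ≡⟨ ones-cong (λ b → ∧-not-∨ (Z a b) (marked a b) (marked⇒one a b)) ⟩
        ones (Z a)
          ≡⟨ ThreeRegular.rows regular a ⟩
        3 ∎
      ... | last = begin
        ones (extend Z ℓ)
          ≡⟨ ones-last (extend Z ℓ) ⟩
        ∑[ b < m ] b2n (extend Z ℓ (ι b)) + b2n (extend Z ℓ ℓ)
          ≡⟨ cong₂ _+_ (∑-cong (allFin m) (cong b2n ∘ extend-row Z)) (cong b2n (extend-corner Z)) ⟩
        ∑[ b < m ] b2n (lastRow b) + 1
          ≡⟨ cong (_+ 1) (∑<-pair m j≢l) ⟩
        3 ∎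

      extend-cols : ∀ y → ones (λ x → extend Z x y) ≡ 3
      extend-cols y with initOrLast y
      ... | init b = begin
        ones (λ x → extend Z x (ι b))
          ≡⟨ ones-border (λ x → extend Z x (ι b)) _ (λ a → marked a b) (λ a → ∧-not⇒false) (λ a → extend-inner Z a b)
                         (trans (marked-column b) (cong b2n (sym (extend-row Z b)))) ⟩
        ones (λ a → Z a b ∧ not (marked a b) ∨ marked a b)
          ≡⟨ ones-cong (λ a → ∧-not-∨ (Z a b) (marked a b) (marked⇒one a b)) ⟩
        ones (λ a → Z a b)
          ≡⟨ ThreeRegular.cols regular b ⟩
        3 ∎
      ... | last = begin
        ones (λ x → extend Z x ℓ)
          ≡⟨ ones-last (λ x → extend Z x ℓ) ⟩
        ∑[ a < m ] b2n (extend Z (ι a) ℓ) + b2n (extend Z ℓ ℓ)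
          ≡⟨ cong₂ _+_ (∑-cong (allFin m) (cong b2n ∘ extend-column Z)) (cong b2n (extend-corner Z)) ⟩
        ∑[ a < m ] b2n (lastColumn a) + 1
          ≡⟨ cong (_+ 1) (∑<-pair m i≢k) ⟩
        3 ∎

      hole : ∀ {a b} → marked a b ≡ true → not (extend Z (ι a) (ι b)) ≡ true
      hole {a} {b} e = cong not (trans (extend-inner Z a b) (trans (cong (λ c → Z a b ∧ not c) e) (Boolₚ.∧-zeroʳ (Z a b))))

      extend-cornersAt : cornersAt i j k l (extend Z) ≡ true
      extend-cornersAt =
        ∧-true⁺ (∧-true⁺ (threeReg-complete (record { rows = extend-rows ; cols = extend-cols })) (extend-corner Z))
        (∧-true⁺ (trans (extend-column Z i) lastColumn-i) (∧-true⁺ (trans (extend-column Z k) lastColumn-k)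
        (∧-true⁺ (trans (extend-row Z j) lastRow-j) (∧-true⁺ (trans (extend-row Z l) lastRow-l)
        (∧-true⁺ (hole marked-ij) (hole marked-kl))))))

      shrink-extend : shrink (extend Z) ≗ᴹ Z
      shrink-extend a b = trans (cong (_∨ marked a b) (extend-inner Z a b)) (∧-not-∨ (Z a b) (marked a b) (marked⇒one a b))

    module CornersAt {X : Mat (suc m)} (cr : cornersAt i j k l X ≡ true) where

      private
        inΛ : inLam3plus X ≡ true
        inΛ = proj₁ (∧-true⁻ cr)
      open CornerFacts (corners-sound X i j k l (proj₂ (∧-true⁻ {inLam3plus X} cr)))

      regular : ThreeRegular X
      regular = threeReg-sound (proj₁ (∧-true⁻ inΛ))

      corner : X ℓ ℓ ≡ true
      corner = proj₂ (∧-true⁻ {threeReg X} inΛ)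

      marked⇒zero : ∀ a b → marked a b ≡ true → X (ι a) (ι b) ≡ false
      marked⇒zero a b e with marked-cases {a} {b} e
      ... | inj₁ (refl , refl) = hole-ij
      ... | inj₂ (refl , refl) = hole-kl

      lastColumn≡ : ∀ a → lastColumn a ≡ X (ι a) ℓ
      lastColumn≡ = ones≡2⇒indicator (λ a → X (ι a) ℓ) i≢k (ones-init (λ x → X x ℓ) (ThreeRegular.cols regular ℓ) corner)
                                      column-i column-k

      lastRow≡ : ∀ b → lastRow b ≡ X ℓ (ι b)
      lastRow≡ = ones≡2⇒indicator (λ b → X ℓ (ι b)) j≢l (ones-init (X ℓ) (ThreeRegular.rows regular ℓ) corner)
                                   row-j row-l

      shrink-rows : ∀ a → ones (shrink X a) ≡ 3
      shrink-rows a = trans (sym (ones-border (X (ι a)) _ (marked a) (λ b → disjoint-sym (marked⇒zero a b)) (λ b → refl)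
                                    (trans (marked-row a) (cong b2n (lastColumn≡ a)))))
                            (ThreeRegular.rows regular (ι a))

      shrink-cols : ∀ b → ones (λ a → shrink X a b) ≡ 3
      shrink-cols b = trans (sym (ones-border (λ x → X x (ι b)) _ (λ a → marked a b) (λ a → disjoint-sym (marked⇒zero a b)) (λ a → refl)
                                    (trans (marked-column b) (cong b2n (lastRow≡ b)))))
                            (ThreeRegular.cols regular (ι b))

      shrink-onesAt : onesAt i j k l (shrink X) ≡ true
      shrink-onesAt = ∧-true⁺ (threeReg-complete (record { rows = shrink-rows ; cols = shrink-cols }))
                              (∧-true⁺ (filled marked-ij) (filled marked-kl))
        where
        filled : ∀ {a b} → marked a b ≡ true → shrink X a b ≡ true
        filled {a} {b} e = trans (cong (X (ι a) (ι b) ∨_) e) (Boolₚ.∨-zeroʳ _)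

      extend-shrink : extend (shrink X) ≗ᴹ X
      extend-shrink x y with initOrLast x | initOrLast y
      ... | init a | init b = trans (extend-inner (shrink X) a b) (∨-∧-not (X (ι a) (ι b)) (marked a b) (marked⇒zero a b))
      ... | init a | last   = trans (extend-column (shrink X) a) (lastColumn≡ a)
      ... | last   | init b = trans (extend-row (shrink X) b) (lastRow≡ b)
      ... | last   | last   = trans (extend-corner (shrink X)) (sym corner)

    correspondence : Correspondence (onesAt i j k l) (cornersAt i j k l)
    correspondence = record
      { to        = extend
      ; from      = shrink
      ; to-cong   = extend-cong
      ; from-cong = shrink-cong
      ; P-cong    = λ Z≗Z′ → cong₂ _∧_ (threeReg-cong Z≗Z′) (cong₂ _∧_ (Z≗Z′ i j) (Z≗Z′ k l))
      ; Q-cong    = λ X≗X′ → cong₂ _∧_ (inLam3plus-cong X≗X′) (corners-cong X≗X′ i j k l)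
      ; to-Q      = λ {Z} → OnesAt.extend-cornersAt {Z}
      ; from-P    = λ {X} → CornersAt.shrink-onesAt {X}
      ; from∘to   = λ {Z} → OnesAt.shrink-extend {Z}
      ; to∘from   = λ {X} → CornersAt.extend-shrink {X}
      }

  apart-count : {m : ℕ} (i j k l : Fin m) → apart i j k l * count (onesAt i j k l) ≡ apart i j k l * count (cornersAt i j k l)
  apart-count i j k l with i == k in i==k | j == l in j==l
  ... | true  | _     = refl
  ... | false | true  = refl
  ... | false | false = cong (1 *_) (count-correspondence (LastLineDeletion.correspondence i j k l i==k j==l))

  -- Counting corner configurations

  ∑<-apart-pair : {m : ℕ} (v : Fin m → Bool) {s t : Fin m} → positions v ≡ s ∷ t ∷ [] → s == t ≡ false →
                  (g : Fin m → Fin m → ℕ) →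
                  ∑[ i < m ] ∑[ k < m ] (b2n (v i) * (b2n (v k) * (b2n (not (i == k)) * g i k))) ≡ g s t + g t s
  ∑<-apart-pair {m} v {s} {t} pos s≢t g = begin
    ∑[ i < m ] ∑[ k < m ] (b2n (v i) * (b2n (v k) * h i k))
      ≡⟨ ∑-cong (allFin m) (λ i → ∑-*ˡ (allFin m) (b2n (v i)) _) ⟩
    ∑[ i < m ] (b2n (v i) * ∑[ k < m ] (b2n (v k) * h i k))
      ≡⟨ ∑-positions v _ ⟨
    ∑[ i ∈ positions v ] ∑[ k < m ] (b2n (v k) * h i k)
      ≡⟨ ∑-cong (positions v) (λ i → ∑-positions v (h i)) ⟨
    ∑[ i ∈ positions v ] ∑[ k ∈ positions v ] h i k
      ≡⟨ cong (λ xs → ∑[ i ∈ xs ] ∑[ k ∈ xs ] h i k) pos ⟩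
    ∑[ i ∈ s ∷ t ∷ [] ] ∑[ k ∈ s ∷ t ∷ [] ] h i k
      ≡⟨ two-point ⟩
    g s t + g t s ∎
    where
    h : Fin m → Fin m → ℕ
    h i k = b2n (not (i == k)) * g i k
    two-point : ∑[ i ∈ s ∷ t ∷ [] ] ∑[ k ∈ s ∷ t ∷ [] ] h i k ≡ g s t + g t s
    two-point rewrite ==-refl s | ==-refl t | s≢t | ==-sym t s | s≢t = shape (g s t) (g t s)
      where
      shape : ∀ a b → 0 + (1 * a + 0) + (1 * b + (0 + 0) + 0) ≡ a + b
      shape = solve-∀

  cornerCount : {m : ℕ} → Mat (suc m) → ℕ
  cornerCount {m} X = ∑[ i ∙ j < m ] ∑[ k ∙ l < m ] (apart i j k l * b2n (corners X i j k l))

  crossZeros : Quad → ℕ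
  crossZeros (a , b , c , d) = b2n (not a ∧ not d) + b2n (not b ∧ not c)

  module _ {m : ℕ} {X : Mat (suc m)} (L : LastLines X) where

    open LastLines L

    private
      ι : Fin m → Fin (suc m)
      ι = inject₁
      ℓ : Fin (suc m)
      ℓ = fromℕ m

      c r : Fin m → ℕ
      c a = b2n (X (ι a) ℓ)
      r b = b2n (X ℓ (ι b))

      N : Fin m → Fin m → ℕ
      N a b = b2n (not (X (ι a) (ι b)))

      d : Fin m → Fin m → ℕ
      d a a′ = b2n (not (a == a′))

      G : Fin m → Fin m → ℕ
      G i k = N i p * N k q + N i q * N k p

      rearrange : ∀ dik djl ci ck rj rl n → dik * djl * (ci * (ck * (rj * (rl * n)))) ≡ ci * (ck * (dik * (rj * (rl * (djl * n)))))
      rearrange = solve-∀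

      summand : ∀ i j k l → apart i j k l * b2n (corners X i j k l)
                          ≡ c i * (c k * (d i k * (r j * (r l * (d j l * (N i j * N k l))))))
      summand i j k l = begin
        apart i j k l * b2n (corners X i j k l)
          ≡⟨ cong (apart i j k l *_) (trans (b2n-∧ (X (ι i) ℓ) _) (cong (c i *_) (trans (b2n-∧ (X (ι k) ℓ) _) (cong (c k *_)
               (trans (b2n-∧ (X ℓ (ι j)) _) (cong (r j *_) (trans (b2n-∧ (X ℓ (ι l)) _)
               (cong (r l *_) (b2n-∧ (not (X (ι i) (ι j))) (not (X (ι k) (ι l)))))))))))) ⟩
        d i k * d j l * (c i * (c k * (r j * (r l * (N i j * N k l)))))
          ≡⟨ rearrange (d i k) (d j l) (c i) (c k) (r j) (r l) (N i j * N k l) ⟩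
        c i * (c k * (d i k * (r j * (r l * (d j l * (N i j * N k l)))))) ∎

      inner : ∀ i k → ∑[ j ∙ l < m ] (c i * (c k * (d i k * (r j * (r l * (d j l * (N i j * N k l)))))))
                    ≡ c i * (c k * (d i k * G i k))
      inner i k = begin
        ∑[ j ∙ l < m ] (c i * (c k * (d i k * (r j * (r l * (d j l * (N i j * N k l)))))))
          ≡⟨ ∑²-*ˡ m (c i) _ ⟩
        c i * ∑[ j ∙ l < m ] (c k * (d i k * (r j * (r l * (d j l * (N i j * N k l))))))
          ≡⟨ cong (c i *_) (trans (∑²-*ˡ m (c k) _) (cong (c k *_) (∑²-*ˡ m (d i k) _))) ⟩
        c i * (c k * (d i k * ∑[ j ∙ l < m ] (r j * (r l * (d j l * (N i j * N k l))))))
          ≡⟨ cong (λ x → c i * (c k * (d i k * x))) (∑<-apart-pair _ row p≢q (λ j l → N i j * N k l)) ⟩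
        c i * (c k * (d i k * G i k)) ∎

    cornerCount-crossZeros : cornerCount X ≡ 2 * crossZeros X̃
    cornerCount-crossZeros = begin
      cornerCount X
        ≡⟨ ∑²-cong m (λ i j → ∑²-cong m (summand i j)) ⟩
      ∑[ i ∙ j < m ] ∑[ k ∙ l < m ] (c i * (c k * (d i k * (r j * (r l * (d j l * (N i j * N k l)))))))
        ≡⟨ ∑-cong (allFin m) (λ i → ∑-comm (allFin m) (allFin m) _) ⟩
      ∑[ i ∙ k < m ] ∑[ j ∙ l < m ] (c i * (c k * (d i k * (r j * (r l * (d j l * (N i j * N k l)))))))
        ≡⟨ ∑²-cong m inner ⟩
      ∑[ i ∙ k < m ] (c i * (c k * (d i k * G i k)))
        ≡⟨ ∑<-apart-pair _ column s≢t G ⟩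
      G s t + G t s
        ≡⟨ twice (N s p) (N s q) (N t p) (N t q) ⟩
      2 * (N s p * N t q + N s q * N t p)
        ≡⟨ cong (2 *_) (cong₂ _+_ (b2n-∧ (not (X (ι s) (ι p))) _) (b2n-∧ (not (X (ι s) (ι q))) _)) ⟨
      2 * crossZeros X̃ ∎
      where
      twice : ∀ a b c d → (a * d + b * c) + (c * b + d * a) ≡ 2 * (a * d + b * c)
      twice = solve-∀

  cornerCount-total : (m : ℕ) → ∑[ X ∈ allMats (suc m) ] (b2n (inLam3plus X) * cornerCount X)
                               ≡ ∑[ Z ∈ allMats m ] (b2n (threeReg Z) * pairsApart Z)
  cornerCount-total m = begin
    ∑[ X ∈ allMats (suc m) ] (b2n (inLam3plus X) * cornerCount X)
      ≡⟨ ∑-*-∑⁴-comm (allMats (suc m)) m (b2n ∘ inLam3plus) (λ X i j k l → apart i j k l * b2n (corners X i j k l)) ⟩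
    ∑[ i ∙ j < m ] ∑[ k ∙ l < m ] ∑[ X ∈ allMats (suc m) ] (b2n (inLam3plus X) * (apart i j k l * b2n (corners X i j k l)))
      ≡⟨ ∑²-cong m (λ i j → ∑²-cong m (λ k l → ∑-b2n-∧ (allMats (suc m)) inLam3plus (λ X → corners X i j k l) (apart i j k l))) ⟩
    ∑[ i ∙ j < m ] ∑[ k ∙ l < m ] (apart i j k l * count (cornersAt i j k l))
      ≡⟨ ∑²-cong m (λ i j → ∑²-cong m (λ k l → apart-count i j k l)) ⟨
    ∑[ i ∙ j < m ] ∑[ k ∙ l < m ] (apart i j k l * count (onesAt i j k l))
      ≡⟨ ∑²-cong m (λ i j → ∑²-cong m (λ k l → ones-collapse i j k l)) ⟨
    ∑[ i ∙ j < m ] ∑[ k ∙ l < m ] ∑[ Z ∈ allMats m ] (b2n (threeReg Z) * (apart i j k l * (b2n (Z i j) * b2n (Z k l))))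
      ≡⟨ ∑-*-∑⁴-comm (allMats m) m (b2n ∘ threeReg) (λ Z i j k l → apart i j k l * (b2n (Z i j) * b2n (Z k l))) ⟨
    ∑[ Z ∈ allMats m ] (b2n (threeReg Z) * pairsApart Z) ∎
    where
    ones-collapse : ∀ i j k l → ∑[ Z ∈ allMats m ] (b2n (threeReg Z) * (apart i j k l * (b2n (Z i j) * b2n (Z k l))))
                                ≡ apart i j k l * count (onesAt i j k l)
    ones-collapse i j k l = trans (∑-cong (allMats m) (λ Z → cong (λ x → b2n (threeReg Z) * (apart i j k l * x)) (sym (b2n-∧ (Z i j) (Z k l)))))
                                  (∑-b2n-∧ (allMats m) threeReg (λ Z → Z i j ∧ Z k l) (apart i j k l))

  -- The recurrence

  quad-identity : ∀ y → 1 + b2n (isAll0 y) ≡ crossZeros y + b2n (isAll1 y) + b2n (isThree1 y) + b2n (isGamma y) + b2n (isRowPair y)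
  quad-identity (true  , true  , true  , true ) = refl
  quad-identity (true  , true  , true  , false) = refl
  quad-identity (true  , true  , false , true ) = refl
  quad-identity (true  , true  , false , false) = refl
  quad-identity (true  , false , true  , true ) = refl
  quad-identity (true  , false , true  , false) = refl
  quad-identity (true  , false , false , true ) = refl
  quad-identity (true  , false , false , false) = refl
  quad-identity (false , true  , true  , true ) = refl
  quad-identity (false , true  , true  , false) = refl
  quad-identity (false , true  , false , true ) = refl
  quad-identity (false , true  , false , false) = refl
  quad-identity (false , false , true  , true ) = refl
  quad-identity (false , false , true  , false) = refl
  quad-identity (false , false , false , true ) = refl
  quad-identity (false , false , false , false) = refl

  module _ (m : ℕ) where

    private
      weight : (Quad → Bool) → Mat (suc m) → ℕ
      weight P X = b2n (plusPred P m X)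

      #_ : (Quad → Bool) → ℕ
      # P = count (plusPred P m)

      any : Quad → Bool
      any _ = true

      corner : Mat (suc m) → ℕ
      corner X = b2n (inLam3plus X) * cornerCount X

    per-matrix : ∀ X → 2 * weight any X + 2 * weight isAll0 X
                     ≡ corner X + 2 * weight isAll1 X + 2 * weight isThree1 X + 2 * weight isGamma X + 2 * weight isRowPair X
    per-matrix X = by-membership (inLam3plus X) refl
      where
      Goal : Set
      Goal = 2 * weight any X + 2 * weight isAll0 X
             ≡ corner X + 2 * weight isAll1 X + 2 * weight isThree1 X + 2 * weight isGamma X + 2 * weight isRowPair X
      vanish : ∀ {T Z C A B G R} → T ≡ 0 → Z ≡ 0 → C ≡ 0 → A ≡ 0 → B ≡ 0 → G ≡ 0 → R ≡ 0 →
               2 * T + 2 * Z ≡ C + 2 * A + 2 * B + 2 * G + 2 * R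
      vanish refl refl refl refl refl refl refl = refl
      spread : ∀ {C c A a B b G g R r} → C ≡ 2 * c → A ≡ a → B ≡ b → G ≡ g → R ≡ r →
               2 * (c + a + b + g + r) ≡ C + 2 * A + 2 * B + 2 * G + 2 * R
      spread {c = c} {a = a} {b = b} {g = g} {r = r} refl refl refl refl refl = distribute c a b g r
        where
        distribute : ∀ c a b g r → 2 * (c + a + b + g + r) ≡ 2 * c + 2 * a + 2 * b + 2 * g + 2 * r
        distribute = solve-∀
      by-membership : ∀ b → inLam3plus X ≡ b → Goal
      by-membership false e = vanish (outside any) (outside isAll0) (cong (λ b → b2n b * cornerCount X) e)
                                     (outside isAll1) (outside isThree1) (outside isGamma) (outside isRowPair)
        where
        outside : ∀ P → weight P X ≡ 0
        outside P = cong b2n (plusPred-outside P {X = X} e)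
      by-membership true e = begin
        2 * weight any X + 2 * weight isAll0 X
          ≡⟨ cong₂ (λ u v → 2 * u + 2 * v) (inside any) (inside isAll0) ⟩
        2 * 1 + 2 * b2n (isAll0 y)
          ≡⟨ *-distribˡ-+ 2 1 _ ⟨
        2 * (1 + b2n (isAll0 y))
          ≡⟨ cong (2 *_) (quad-identity y) ⟩
        2 * (crossZeros y + b2n (isAll1 y) + b2n (isThree1 y) + b2n (isGamma y) + b2n (isRowPair y))
          ≡⟨ spread {c = crossZeros y} corner≡ (inside isAll1) (inside isThree1) (inside isGamma) (inside isRowPair) ⟩
        corner X + 2 * weight isAll1 X + 2 * weight isThree1 X + 2 * weight isGamma X + 2 * weight isRowPair X ∎
        where
        L : LastLines X
        L = lastLines {X = X} e
        y : Quad
        y = LastLines.X̃ L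
        inside : ∀ P → weight P X ≡ b2n (P y)
        inside P = cong b2n (plusPred-inside P {X = X} e)
        corner≡ : corner X ≡ 2 * crossZeros y
        corner≡ = trans (cong (λ b → b2n b * cornerCount X) e) (trans (*-identityˡ _) (cornerCount-crossZeros L))

    weighted-total : 2 * # any + 2 * # isAll0
                     ≡ ∑ (allMats (suc m)) corner + 2 * # isAll1 + 2 * # isThree1 + 2 * # isGamma + 2 * # isRowPair
    weighted-total = begin
      2 * # any + 2 * # isAll0
        ≡⟨ cong (_+ 2 * # isAll0) (∑-*ˡ Xs 2 (weight any)) ⟨
      ∑[ X ∈ Xs ] (2 * weight any X) + 2 * # isAll0
        ≡⟨ ∑-+-2* Xs (λ X → 2 * weight any X) (weight isAll0) ⟨
      ∑[ X ∈ Xs ] (2 * weight any X + 2 * weight isAll0 X)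
        ≡⟨ ∑-cong Xs per-matrix ⟩
      ∑[ X ∈ Xs ] (corner X + 2 * weight isAll1 X + 2 * weight isThree1 X + 2 * weight isGamma X + 2 * weight isRowPair X)
        ≡⟨ trans (∑-+-2* Xs _ (weight isRowPair)) (cong (_+ 2 * # isRowPair)
             (trans (∑-+-2* Xs _ (weight isGamma)) (cong (_+ 2 * # isGamma)
             (trans (∑-+-2* Xs _ (weight isThree1)) (cong (_+ 2 * # isThree1) (∑-+-2* Xs corner (weight isAll1))))))) ⟩
      ∑ Xs corner + 2 * # isAll1 + 2 * # isThree1 + 2 * # isGamma + 2 * # isRowPair ∎
      where
      Xs : List (Mat (suc m))
      Xs = allMats (suc m)

    recurrenceℕ : 2 * lam3plus (suc m) + 2 * eta (suc m) + lam3 m * (6 * (3 * m))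
                  ≡ lam3 m * (3 * m * (3 * m) + 3 * m) + 2 * alpha (suc m) + 2 * beta (suc m) + 4 * gamma (suc m)
    recurrenceℕ
      rewrite countPlus≡count any m | countPlus≡count isAll0 m | countPlus≡count isAll1 m
            | countPlus≡count isThree1 m | countPlus≡count isGamma m = begin
      2 * # any + 2 * # isAll0 + c
        ≡⟨ cong (_+ c) weighted-total ⟩
      Q + 2 * # isAll1 + 2 * # isThree1 + 2 * # isGamma + 2 * # isRowPair + c
        ≡⟨ cong (λ u → Q + 2 * # isAll1 + 2 * # isThree1 + 2 * # isGamma + 2 * u + c) rows≡columns ⟩
      Q + 2 * # isAll1 + 2 * # isThree1 + 2 * # isGamma + 2 * # isGamma + c
        ≡⟨ regroup Q (# isAll1) (# isThree1) (# isGamma) c ⟩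
      (Q + c) + 2 * # isAll1 + 2 * # isThree1 + 4 * # isGamma
        ≡⟨ cong (λ u → u + 2 * # isAll1 + 2 * # isThree1 + 4 * # isGamma)
                (trans (cong (_+ c) (cornerCount-total m)) (regular-total m)) ⟩
      lam3 m * (3 * m * (3 * m) + 3 * m) + 2 * # isAll1 + 2 * # isThree1 + 4 * # isGamma ∎
      where
      c : ℕ
      c = lam3 m * (6 * (3 * m))
      Q : ℕ
      Q = ∑ (allMats (suc m)) corner
      rows≡columns : # isRowPair ≡ # isGamma
      rows≡columns = count-correspondence (transpose-correspondence m)
      regroup : ∀ q a b g x → q + 2 * a + 2 * b + 2 * g + 2 * g + x ≡ (q + x) + 2 * a + 2 * b + 4 * g
      regroup = solve-∀

open Counting using (recurrenceℕ)

import Data.Nat as ℕ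
open import Data.Nat using (ℕ; zero; suc; _≤_; _∸_)
open import Data.Integer using (ℤ; +_; _+_; _-_; _*_)
open import Data.Integer.Properties using (pos-*)
open import Data.Integer.Tactic.RingSolver using (solve-∀)
open import Relation.Binary.PropositionalEquality using (_≡_; sym; trans; cong; cong₂)

ℕ-recurrence⇒ℤ : ∀ lp e l a b g m →
  2 ℕ.* lp ℕ.+ 2 ℕ.* e ℕ.+ l ℕ.* (6 ℕ.* (3 ℕ.* m))
    ≡ l ℕ.* (3 ℕ.* m ℕ.* (3 ℕ.* m) ℕ.+ 3 ℕ.* m) ℕ.+ 2 ℕ.* a ℕ.+ 2 ℕ.* b ℕ.+ 4 ℕ.* g →
  + 2 * + lp ≡ + 3 * + m * (+ 3 * + suc m - + 8) * + l + + 2 * + a + + 2 * + b + + 4 * + g - + 2 * + e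
ℕ-recurrence⇒ℤ lp e l a b g m eq =
  trans (isolate (+ lp) (+ e) (+ l) (+ m))
        (trans (cong (λ z → z - + 2 * + e - + l * (+ 6 * (+ 3 * + m))) embedded)
               (collect (+ lp) (+ e) (+ l) (+ a) (+ b) (+ g) (+ m)))
  where
  three-m : + (3 ℕ.* m) ≡ + 3 * + m
  three-m = pos-* 3 m
  lhs : + (2 ℕ.* lp ℕ.+ 2 ℕ.* e ℕ.+ l ℕ.* (6 ℕ.* (3 ℕ.* m))) ≡ + 2 * + lp + + 2 * + e + + l * (+ 6 * (+ 3 * + m))
  lhs = cong₂ _+_ (cong₂ _+_ (pos-* 2 lp) (pos-* 2 e))
                  (trans (pos-* l (6 ℕ.* (3 ℕ.* m))) (cong (+ l *_) (trans (pos-* 6 (3 ℕ.* m)) (cong (+ 6 *_) three-m))))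
  rhs : + (l ℕ.* (3 ℕ.* m ℕ.* (3 ℕ.* m) ℕ.+ 3 ℕ.* m) ℕ.+ 2 ℕ.* a ℕ.+ 2 ℕ.* b ℕ.+ 4 ℕ.* g)
        ≡ + l * (+ 3 * + m * (+ 3 * + m) + + 3 * + m) + + 2 * + a + + 2 * + b + + 4 * + g
  rhs = cong₂ _+_ (cong₂ _+_ (cong₂ _+_
          (trans (pos-* l (3 ℕ.* m ℕ.* (3 ℕ.* m) ℕ.+ 3 ℕ.* m))
                 (cong (+ l *_) (cong₂ _+_ (trans (pos-* (3 ℕ.* m) (3 ℕ.* m)) (cong₂ _*_ three-m three-m)) three-m)))
          (pos-* 2 a)) (pos-* 2 b)) (pos-* 4 g)
  embedded : + 2 * + lp + + 2 * + e + + l * (+ 6 * (+ 3 * + m))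
             ≡ + l * (+ 3 * + m * (+ 3 * + m) + + 3 * + m) + + 2 * + a + + 2 * + b + + 4 * + g
  embedded = trans (sym lhs) (trans (cong +_ eq) rhs)
  isolate : ∀ LP E L M → + 2 * LP ≡ (+ 2 * LP + + 2 * E + L * (+ 6 * (+ 3 * M))) - + 2 * E - L * (+ 6 * (+ 3 * M))
  isolate = solve-∀
  collect : ∀ LP E L A B G M →
            (L * (+ 3 * M * (+ 3 * M) + + 3 * M) + + 2 * A + + 2 * B + + 4 * G) - + 2 * E - L * (+ 6 * (+ 3 * M))
            ≡ + 3 * M * (+ 3 * (+ 1 + M) - + 8) * L + + 2 * A + + 2 * B + + 4 * G - + 2 * E
  collect = solve-∀

theorem4 : (n : ℕ) → 2 ≤ n →
    + 2 * + lam3plus n ≡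
      + 3 * + (n ∸ 1) * (+ 3 * + n - + 8) * + lam3 (n ∸ 1)
        + + 2 * + alpha n + + 2 * + beta n + + 4 * + gamma n - + 2 * + eta n
theorem4 zero    ()
theorem4 (suc m) _ = ℕ-recurrence⇒ℤ (lam3plus (suc m)) (eta (suc m)) (lam3 m)
                                     (alpha (suc m)) (beta (suc m)) (gamma (suc m)) m (recurrenceℕ m)
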